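{- For every integer $d\ge 3$ there is an (explicitly constructible) mutual-visibility set $X$ of the cube-connected cycle $\mathit{CCC}_d$ such that $\mu(\mathit{CCC}_d)/|X| \le 3\cdot 2^{\lfloor d/2\rfloor-1}$; that is, there is a $3\cdot 2^{\lfloor d/2\rfloor-1}$-approximation algorithm for the problem of computing a maximum mutual-visibility set of $\mathit{CCC}_d$.
   Context: For a connected graph $G$ and $X\subseteq V(G)$, two vertices $x,y\in V(G)$ are $X$-visible if there is a shortest $x,y$-path none of whose internal vertices lies in $X$. $X$ is a mutual-visibility set if every two vertices of $X$ are $X$-visible; $\mu(G)$ is the maximum cardinality of a mutual-visibility set of $G$. For $d\ge 3$, the cube-connected cycle $\mathit{CCC}_d$ has vertex set $\{[\ell,x] : \ell\in\{0,\dots,d-1\},\ x\in\{0,1\}^d\}$, where bit positions of $x$ are numbered $0,\dots,d-1$ from the left; $[\ell,x]$ and $[\ell',x']$ are adjacent if and only if either $x=x'$ and $\ell'\equiv \ell\pm 1 \pmod d$, or $\ell=\ell'$ and $x'$ is obtained from $x$ by complementing the bit in position $\ell$. -}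

module Defs where

open import Data.Nat using (ℕ; zero; suc; _≤_)
open import Data.Fin using (Fin; toℕ)
open import Data.Bool using (Bool; not)
open import Data.Vec using (Vec; updateAt)
open import Data.List using (List; []; _∷_; drop)
open import Data.List.Membership.Propositional using (_∈_; _∉_)
open import Data.List.Relation.Unary.All using (All)
open import Data.List.Relation.Unary.Unique.Propositional using (Unique)
open import Data.Product using (Σ; _×_)
open import Data.Sum using (_⊎_)
open import Relation.Binary.PropositionalEquality using (_≡_)

-- Vertices [ℓ , x] of CCC_d: ℓ ∈ {0..d-1}, x a bit string of length d,
-- bit positions numbered 0..d-1 from the left (= Vec index).
Vertex : ℕ → Set
Vertex d = Fin d × Vec Bool d

CycNext : {d : ℕ} → Fin d → Fin d → Set
CycNext {d} ℓ ℓ' = (suc (toℕ ℓ) ≡ toℕ ℓ') ⊎ ((suc (toℕ ℓ) ≡ d) × (toℕ ℓ' ≡ 0))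

flipBit : {d : ℕ} → Vec Bool d → Fin d → Vec Bool d
flipBit x ℓ = updateAt x ℓ not

Adj : (d : ℕ) → Vertex d → Vertex d → Set
Adj d (ℓ Data.Product., x) (ℓ' Data.Product., x') =
  ((x ≡ x') × (CycNext ℓ ℓ' ⊎ CycNext ℓ' ℓ))
  ⊎ ((ℓ ≡ ℓ') × (x' ≡ flipBit x ℓ))

data Walk (d : ℕ) : Vertex d → Vertex d → Set where
  [] : ∀ {u} → Walk d u u
  _∷_ : ∀ {u v w} → Adj d u v → Walk d v w → Walk d u w

len : ∀ {d u v} → Walk d u v → ℕ
len [] = 0
len (_ ∷ p) = suc (len p)

initVerts : ∀ {d u v} → Walk d u v → List (Vertex d)
initVerts [] = []
initVerts (_∷_ {u = u} _ p) = u ∷ initVerts p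

internal : ∀ {d u v} → Walk d u v → List (Vertex d)
internal p = drop 1 (initVerts p)

IsShortest : ∀ {d u v} → Walk d u v → Set
IsShortest {d} {u} {v} p = (q : Walk d u v) → len p ≤ len q

Visible : (d : ℕ) → List (Vertex d) → Vertex d → Vertex d → Set
Visible d X u v =
  Σ (Walk d u v) λ p → IsShortest p × All (λ z → z ∉ X) (internal p)

IsMutualVisibilitySet : (d : ℕ) → List (Vertex d) → Set
IsMutualVisibilitySet d X =
  Unique X × (∀ {u v} → u ∈ X → v ∈ X → Visible d X u v)

module Submission where

-- If a mutual-visibility set Y met the cycle of a bit string x in four
-- levels l₁ < l₂ < l₃ < l₄, then [l₁, x] and [l₃, x] would not be Y-visible: the
-- potential "Hamming distance to x + cyclic distance to l₃ + 2 on the arc of the cycle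
-- of x around l₁" drops by at most one per step of a walk avoiding [l₂, x] and [l₄, x],
-- so such a walk is longer than the cyclic distance. Counting cycle by cycle,
-- μ(CCC_d) ≤ 3·2^d.
--
-- For d = c + k + 2 with c = ⌈d/2⌉ the 2^(c+1) vertices [0, b v 0ᵏ b]
-- are mutually visible. Between two of them take the walk that moves along the cycles
-- from level 0 back to level 0 and flips each differing bit when it passes that level.
-- The potential "remaining flips + shortest cyclic tour through the one or two levels
-- that are farthest to visit" shows that, for a suitable choice of moves, this walk is
-- shortest; and it meets the set only at its ends, because it leaves level 0 right
-- after flipping the first bit, which then differs from the last one.
-- As 3·2^d = 3·2^(⌊d/2⌋-1)·2^(c+1), this is the claimed approximation.
--
-- For d = 3 a set of six vertices is checked by evaluation, and μ(CCC_3) ≤ 16, because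
-- a cycle carrying three vertices of Y leaves the neighbouring cycle across level 0
-- empty.

open import Defs
open import Data.Nat using (ℕ; zero; suc; _+_; _*_; _∸_; _^_; _/_; _%_; _⊓_; _≤_; _<_; z≤n; s≤s; z<s; s≤s⁻¹; _≟_; _≤?_; _<?_; ∣_-_∣; NonZero)
open import Data.Nat.Properties
open import Algebra.Properties.CommutativeSemigroup +-commutativeSemigroup using (x∙yz≈y∙xz; xy∙z≈zy∙x; interchange)
open import Data.Nat.DivMod using (m≡m%n+[m/n]*n; m%n<n; m<n⇒m%n≡m; [m+n]%n≡m%n; %-distribˡ-+; m%n%n≡m%n; n%n≡0; /-monoˡ-≤)
open import Data.Nat.ListAction using (sum)
open import Data.Nat.ListAction.Properties using (sum-++)
open import Data.Nat.Tactic.RingSolver using (solve-∀)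
open import Data.Fin using (Fin; zero; suc; toℕ; fromℕ; fromℕ<; inject₁; _↑ˡ_; _↑ʳ_; join; splitAt; #_)
import Data.Fin.Properties as Fin
open import Data.Bool using (Bool; true; false; not; if_then_else_; _xor_)
import Data.Bool as Bool
open import Data.Bool.Properties using (not-involutive; xor-same; not-distribˡ-xor; not-¬; ¬-not)
open import Data.Vec using (Vec; []; _∷_; lookup; tabulate) renaming (_++_ to _++ᵛ_)
import Data.Vec as Vec
open import Data.Vec.Properties using (≡-dec; ∷-injectiveʳ; lookup-++ˡ; lookup-++ʳ; lookup∘updateAt; lookup∘updateAt′; tabulate∘lookup; tabulate-cong; updateAt-updateAt; updateAt-cong; updateAt-id)
open import Data.List using (List; []; _∷_; length; _++_; replicate; map; filter; applyUpTo)
open import Data.List.Properties using (length-++; length-map; length-replicate; map-++; map-∘; map-cong)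
open import Data.List.Membership.Propositional using (_∈_; _∉_)
import Data.List.Membership.Propositional.Properties as ∈
open import Data.List.Relation.Unary.All as All using (All; []; _∷_)
import Data.List.Relation.Unary.All.Properties as All
open import Data.List.Relation.Unary.Any using (here; there)
open import Data.List.Relation.Unary.AllPairs using ([]; _∷_)
open import Data.List.Relation.Unary.Unique.Propositional using (Unique)
import Data.List.Relation.Unary.Unique.Propositional.Properties as Unique
open import Data.List.Relation.Unary.Linked using (Linked; []; [-]; _∷_)
import Data.List.Relation.Binary.Permutation.Propositional as ↭
import Data.List.Relation.Binary.Permutation.Propositional.Properties as ↭
import Data.List.Relation.Binary.Permutation.Setoid.Properties as ↭ₛ
open import Data.Product using (Σ; _×_; _,_; proj₁; proj₂)
open import Data.Product.Properties using () renaming (≡-dec to ×-≡-dec)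
open import Data.Sum using (_⊎_; inj₁; inj₂)
open import Data.Unit using (⊤; tt)
open import Function using (_∘_; _$_)
open import Relation.Nullary using (¬_; ¬?; yes; no; contradiction; Dec; does; _×-dec_)
open import Relation.Nullary.Decidable using (True; toWitness)
open import Relation.Binary.Definitions using (DecidableEquality)
open import Relation.Binary.PropositionalEquality

variable
  n d : ℕ

infixr 5 _++ʷ_

_++ʷ_ : ∀ {u v w} → Walk d u v → Walk d v w → Walk d u w
[] ++ʷ q = q
(e ∷ p) ++ʷ q = e ∷ (p ++ʷ q)

len-++ʷ : ∀ {u v w} (p : Walk d u v) (q : Walk d v w) → len (p ++ʷ q) ≡ len p + len q
len-++ʷ [] q = refl
len-++ʷ (e ∷ p) q = cong suc (len-++ʷ p q)

initVerts-++ʷ : ∀ {u v w} (p : Walk d u v) (q : Walk d v w) →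
  initVerts (p ++ʷ q) ≡ initVerts p ++ initVerts q
initVerts-++ʷ [] q = refl
initVerts-++ʷ (e ∷ p) q = cong (_ ∷_) (initVerts-++ʷ p q)

All-internal-++ʷ : ∀ {P : Vertex d → Set} {u v w} (p : Walk d u v) (q : Walk d v w) →
  All P (internal p) → All P (initVerts q) → All P (internal (p ++ʷ q))
All-internal-++ʷ [] q _ Pq = All.drop⁺ 1 Pq
All-internal-++ʷ (e ∷ p) q Pp Pq rewrite initVerts-++ʷ p q = All.++⁺ Pp Pq

All-initVerts : ∀ {P : Vertex d → Set} {u v} (p : Walk d u v) →
  P u → All P (internal p) → All P (initVerts p)
All-initVerts [] _ _ = []
All-initVerts (e ∷ p) Pu Pp = Pu ∷ Pp

module _ (f : Vertex d → ℕ) (Allowed : Vertex d → Set) (t : Vertex d)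
  (f-step : ∀ {u w} → Adj d u w → Allowed u → Allowed w ⊎ w ≡ t → f u ≤ suc (f w))
  (f-target : f t ≡ 0) where

  potential≤len : ∀ {s} (p : Walk d s t) → Allowed s → All Allowed (internal p) → f s ≤ len p
  potential≤len [] _ _ = ≤-reflexive f-target
  potential≤len {s} (e ∷ []) As _ = subst (λ k → f s ≤ suc k) f-target (f-step e As (inj₂ refl))
  potential≤len (e ∷ (e′ ∷ q)) As (Av ∷ Aq) =
    ≤-trans (f-step e As (inj₁ Av)) (s≤s (potential≤len (e′ ∷ q) Av Aq))

lipschitz⇒potential≤len : (f : Vertex d → ℕ) {t : Vertex d} →
  (∀ {u w} → Adj d u w → f u ≤ suc (f w)) → f t ≡ 0 →
  ∀ {s} (p : Walk d s t) → f s ≤ len p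
lipschitz⇒potential≤len f {t} f-step f-target p =
  potential≤len f (λ _ → ⊤) t (λ e _ _ → f-step e) f-target p tt (All.universal (λ _ → tt) _)

visible-self : ∀ {X : List (Vertex d)} {u} → Visible d X u u
visible-self = [] , (λ _ → z≤n) , []

[m%n+k]%n≡[m+k]%n : ∀ m k d .{{_ : NonZero d}} → (m % d + k) % d ≡ (m + k) % d
[m%n+k]%n≡[m+k]%n m k d = begin
  (m % d + k) % d           ≡⟨ %-distribˡ-+ (m % d) k d ⟩
  (m % d % d + k % d) % d   ≡⟨ cong (λ z → (z + k % d) % d) (m%n%n≡m%n m d) ⟩
  (m % d + k % d) % d       ≡⟨ %-distribˡ-+ m k d ⟨
  (m + k) % d               ∎
  where open ≡-Reasoning

next : Fin (suc n) → Fin (suc n)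
next {n} a = fromℕ< (m%n<n (suc (toℕ a)) (suc n))

prev : Fin (suc n) → Fin (suc n)
prev zero = fromℕ _
prev (suc i) = inject₁ i

toℕ-next : ∀ (a : Fin (suc n)) → toℕ (next a) ≡ suc (toℕ a) % suc n
toℕ-next a = Fin.toℕ-fromℕ< _

toℕ-next-< : ∀ (a : Fin (suc n)) → suc (toℕ a) < suc n → toℕ (next a) ≡ suc (toℕ a)
toℕ-next-< a lt = trans (toℕ-next a) (m<n⇒m%n≡m lt)

next-cycNext : ∀ (a : Fin (suc n)) → CycNext a (next a)
next-cycNext {n} a with suc (toℕ a) <? suc n
... | yes lt = inj₁ (sym (toℕ-next-< a lt))
... | no ≮ = inj₂ (a+1≡D , trans (toℕ-next a) (trans (cong (_% suc n) a+1≡D) (n%n≡0 (suc n))))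
  where
  a+1≡D : suc (toℕ a) ≡ suc n
  a+1≡D = ≤-antisym (Fin.toℕ<n a) (≮⇒≥ ≮)

prev-cycNext : ∀ (a : Fin (suc n)) → CycNext (prev a) a
prev-cycNext {n} zero = inj₂ (cong suc (Fin.toℕ-fromℕ n) , refl)
prev-cycNext (suc i) = inj₁ (cong suc (Fin.toℕ-inject₁ i))

toℕ-prev-zero : toℕ (prev (zero {n})) ≡ n
toℕ-prev-zero {n} = Fin.toℕ-fromℕ n

suc-toℕ-prev : ∀ (a : Fin (suc n)) → 0 < toℕ a → suc (toℕ (prev a)) ≡ toℕ a
suc-toℕ-prev (suc i) _ = cong suc (Fin.toℕ-inject₁ i)

cycNext-injectiveˡ : ∀ {a a′ c : Fin (suc n)} → CycNext a c → CycNext a′ c → a ≡ a′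
cycNext-injectiveˡ (inj₁ e) (inj₁ e′) = Fin.toℕ-injective (suc-injective (trans e (sym e′)))
cycNext-injectiveˡ (inj₁ e) (inj₂ (_ , c≡0)) = contradiction (trans e c≡0) λ ()
cycNext-injectiveˡ (inj₂ (_ , c≡0)) (inj₁ e′) = contradiction (trans e′ c≡0) λ ()
cycNext-injectiveˡ (inj₂ (e , _)) (inj₂ (e′ , _)) = Fin.toℕ-injective (suc-injective (trans e (sym e′)))

cycNext-injectiveʳ : ∀ {a c c′ : Fin (suc n)} → CycNext a c → CycNext a c′ → c ≡ c′
cycNext-injectiveʳ (inj₁ e) (inj₁ e′) = Fin.toℕ-injective (trans (sym e) e′)
cycNext-injectiveʳ {c = c} (inj₁ e) (inj₂ (e′ , _)) = contradiction
  (subst (_< _) (trans (sym e) e′) (Fin.toℕ<n c)) (<-irrefl refl)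
cycNext-injectiveʳ {c′ = c′} (inj₂ (e , _)) (inj₁ e′) = contradiction
  (subst (_< _) (trans (sym e′) e) (Fin.toℕ<n c′)) (<-irrefl refl)
cycNext-injectiveʳ (inj₂ (_ , c≡0)) (inj₂ (_ , c′≡0)) = Fin.toℕ-injective (trans c≡0 (sym c′≡0))

prev-next : ∀ (a : Fin (suc n)) → prev (next a) ≡ a
prev-next a = cycNext-injectiveˡ (prev-cycNext (next a)) (next-cycNext a)

next-prev : ∀ (a : Fin (suc n)) → next (prev a) ≡ a
next-prev a = cycNext-injectiveʳ (next-cycNext (prev a)) (prev-cycNext a)

data Move : Set where
  fwd bwd : Move

step : Move → Fin (suc n) → Fin (suc n)
step fwd = next
step bwd = prev

step-cycNext : ∀ m (ℓ : Fin (suc n)) → CycNext ℓ (step m ℓ) ⊎ CycNext (step m ℓ) ℓ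
step-cycNext fwd ℓ = inj₁ (next-cycNext ℓ)
step-cycNext bwd ℓ = inj₂ (prev-cycNext ℓ)

endLevel : Fin (suc n) → List Move → Fin (suc n)
endLevel ℓ [] = ℓ
endLevel ℓ (m ∷ ms) = endLevel (step m ℓ) ms

visited : Fin (suc n) → List Move → List (Fin (suc n))
visited ℓ [] = []
visited ℓ (m ∷ ms) = ℓ ∷ visited (step m ℓ) ms

endLevel-++ : ∀ (ℓ : Fin (suc n)) ms ms′ → endLevel ℓ (ms ++ ms′) ≡ endLevel (endLevel ℓ ms) ms′
endLevel-++ ℓ [] ms′ = refl
endLevel-++ ℓ (m ∷ ms) ms′ = endLevel-++ (step m ℓ) ms ms′

visited-++ : ∀ (ℓ : Fin (suc n)) ms ms′ → visited ℓ (ms ++ ms′) ≡ visited ℓ ms ++ visited (endLevel ℓ ms) ms′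
visited-++ ℓ [] ms′ = refl
visited-++ ℓ (m ∷ ms) ms′ = cong (ℓ ∷_) (visited-++ (step m ℓ) ms ms′)

fwds bwds : ℕ → List Move
fwds k = replicate k fwd
bwds k = replicate k bwd

toℕ-endLevel-fwds : ∀ k (a : Fin (suc n)) → toℕ (endLevel a (fwds k)) ≡ (toℕ a + k) % suc n
toℕ-endLevel-fwds {n} zero a = sym (trans (cong (_% suc n) (+-identityʳ (toℕ a))) (m<n⇒m%n≡m (Fin.toℕ<n a)))
toℕ-endLevel-fwds {n} (suc k) a = begin
  toℕ (endLevel (next a) (fwds k))   ≡⟨ toℕ-endLevel-fwds k (next a) ⟩
  (toℕ (next a) + k) % suc n          ≡⟨ cong (λ z → (z + k) % suc n) (toℕ-next a) ⟩
  (suc (toℕ a) % suc n + k) % suc n   ≡⟨ [m%n+k]%n≡[m+k]%n (suc (toℕ a)) k (suc n) ⟩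
  (suc (toℕ a) + k) % suc n           ≡⟨ cong (_% suc n) (+-suc (toℕ a) k) ⟨
  (toℕ a + suc k) % suc n             ∎
  where open ≡-Reasoning

endLevel-fwds : ∀ k (a b : Fin (suc n)) → (toℕ a + k) % suc n ≡ toℕ b → endLevel a (fwds k) ≡ b
endLevel-fwds k a b e = Fin.toℕ-injective (trans (toℕ-endLevel-fwds k a) e)

endLevel-fwds-suc : ∀ k (a : Fin (suc n)) → endLevel a (fwds (suc k)) ≡ next (endLevel a (fwds k))
endLevel-fwds-suc zero a = refl
endLevel-fwds-suc (suc k) a = endLevel-fwds-suc k (next a)

endLevel-bwds-suc : ∀ k (a : Fin (suc n)) → endLevel a (bwds (suc k)) ≡ prev (endLevel a (bwds k))
endLevel-bwds-suc zero a = refl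
endLevel-bwds-suc (suc k) a = endLevel-bwds-suc k (prev a)

fwds-bwds-cancel : ∀ k (a : Fin (suc n)) → endLevel (endLevel a (fwds k)) (bwds k) ≡ a
fwds-bwds-cancel zero a = refl
fwds-bwds-cancel (suc k) a =
  trans (cong (λ z → endLevel z (bwds (suc k))) (endLevel-fwds-suc k a))
    (trans (cong (λ z → endLevel z (bwds k)) (prev-next _)) (fwds-bwds-cancel k a))

bwds-fwds-cancel : ∀ k (a : Fin (suc n)) → endLevel (endLevel a (bwds k)) (fwds k) ≡ a
bwds-fwds-cancel zero a = refl
bwds-fwds-cancel (suc k) a =
  trans (cong (λ z → endLevel z (fwds (suc k))) (endLevel-bwds-suc k a))
    (trans (cong (λ z → endLevel z (fwds k)) (next-prev _)) (bwds-fwds-cancel k a))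

bwds-retraces-fwds : ∀ k (a b : Fin (suc n)) → endLevel b (fwds k) ≡ a → endLevel a (bwds k) ≡ b
bwds-retraces-fwds k a b refl = fwds-bwds-cancel k b

visited-fwds : ∀ k (a : Fin (suc n)) → visited a (fwds k) ≡ applyUpTo (λ i → endLevel a (fwds i)) k
visited-fwds zero a = refl
visited-fwds (suc k) a = cong (a ∷_) (visited-fwds k (next a))

visited-bwds : ∀ k (a : Fin (suc n)) → visited a (bwds k) ≡ applyUpTo (λ i → endLevel a (bwds i)) k
visited-bwds zero a = refl
visited-bwds (suc k) a = cong (a ∷_) (visited-bwds k (prev a))

toℕ-endLevel-fwds-< : ∀ k (a : Fin (suc n)) → toℕ a + k < suc n → toℕ (endLevel a (fwds k)) ≡ toℕ a + k
toℕ-endLevel-fwds-< k a lt = trans (toℕ-endLevel-fwds k a) (m<n⇒m%n≡m lt)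

toℕ-endLevel-bwds-≤ : ∀ k (a : Fin (suc n)) → k ≤ toℕ a → toℕ (endLevel a (bwds k)) + k ≡ toℕ a
toℕ-endLevel-bwds-≤ zero a _ = +-identityʳ _
toℕ-endLevel-bwds-≤ (suc k) a k<a = begin
  toℕ (endLevel (prev a) (bwds k)) + suc k    ≡⟨ +-suc _ k ⟩
  suc (toℕ (endLevel (prev a) (bwds k)) + k)  ≡⟨ cong suc (toℕ-endLevel-bwds-≤ k (prev a) k≤prev) ⟩
  suc (toℕ (prev a))                          ≡⟨ prev+1 ⟩
  toℕ a                                       ∎
  where
  open ≡-Reasoning
  prev+1 : suc (toℕ (prev a)) ≡ toℕ a
  prev+1 = suc-toℕ-prev a (≤-trans (s≤s z≤n) k<a)
  k≤prev : k ≤ toℕ (prev a)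
  k≤prev = s≤s⁻¹ (subst (suc k ≤_) (sym prev+1) k<a)

module _ {a q : Fin (suc n)} {k : ℕ} where

  ∈-visited-fwds⁻ : toℕ a + k ≤ suc n → q ∈ visited a (fwds k) → toℕ a ≤ toℕ q × toℕ q < toℕ a + k
  ∈-visited-fwds⁻ a+k≤D q∈ with ∈.∈-applyUpTo⁻ (λ i → endLevel a (fwds i))
    (subst (q ∈_) (visited-fwds k a) q∈)
  ... | i , i<k , refl = subst (λ z → toℕ a ≤ z × z < toℕ a + k) (sym toℕq)
      (m≤m+n _ i , +-monoʳ-< (toℕ a) i<k)
    where
    toℕq : toℕ (endLevel a (fwds i)) ≡ toℕ a + i
    toℕq = toℕ-endLevel-fwds-< i a (<-≤-trans (+-monoʳ-< (toℕ a) i<k) a+k≤D)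

  ∈-visited-fwds⁺ : toℕ a + k ≤ suc n → toℕ a ≤ toℕ q → toℕ q < toℕ a + k → q ∈ visited a (fwds k)
  ∈-visited-fwds⁺ a+k≤D a≤q q<a+k =
    subst (_∈ visited a (fwds k)) reaches-q
      (subst (endLevel a (fwds i) ∈_) (sym (visited-fwds k a))
        (∈.∈-applyUpTo⁺ (λ i → endLevel a (fwds i)) i<k))
    where
    i : ℕ
    i = toℕ q ∸ toℕ a
    a+i≡q : toℕ a + i ≡ toℕ q
    a+i≡q = m+[n∸m]≡n a≤q
    i<k : i < k
    i<k = +-cancelˡ-< (toℕ a) i k (subst (_< toℕ a + k) (sym a+i≡q) q<a+k)
    reaches-q : endLevel a (fwds i) ≡ q
    reaches-q = Fin.toℕ-injective
      (trans (toℕ-endLevel-fwds-< i a (subst (_< suc n) (sym a+i≡q) (Fin.toℕ<n q))) a+i≡q)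

  ∈-visited-bwds⁻ : k ≤ toℕ a → q ∈ visited a (bwds k) → toℕ q ≤ toℕ a × toℕ a < toℕ q + k
  ∈-visited-bwds⁻ k≤a q∈ with ∈.∈-applyUpTo⁻ (λ i → endLevel a (bwds i)) (subst (q ∈_) (visited-bwds k a) q∈)
  ... | i , i<k , refl = subst (toℕ (endLevel a (bwds i)) ≤_) q+i≡a (m≤m+n _ i) ,
                         subst (_< toℕ (endLevel a (bwds i)) + k) q+i≡a (+-monoʳ-< _ i<k)
    where
    q+i≡a : toℕ (endLevel a (bwds i)) + i ≡ toℕ a
    q+i≡a = toℕ-endLevel-bwds-≤ i a (≤-trans (<⇒≤ i<k) k≤a)

  ∈-visited-bwds⁺ : k ≤ toℕ a → toℕ q ≤ toℕ a → toℕ a < toℕ q + k → q ∈ visited a (bwds k)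
  ∈-visited-bwds⁺ k≤a q≤a a<q+k =
    subst (_∈ visited a (bwds k)) reaches-q
      (subst (endLevel a (bwds i) ∈_) (sym (visited-bwds k a))
        (∈.∈-applyUpTo⁺ (λ i → endLevel a (bwds i)) i<k))
    where
    i : ℕ
    i = toℕ a ∸ toℕ q
    q+i≡a : toℕ q + i ≡ toℕ a
    q+i≡a = m+[n∸m]≡n q≤a
    i<k : i < k
    i<k = +-cancelˡ-< (toℕ q) i k (subst (_< toℕ q + k) (sym q+i≡a) a<q+k)
    reaches-q : endLevel a (bwds i) ≡ q
    reaches-q = Fin.toℕ-injective
      (+-cancelʳ-≡ i _ _ (trans (toℕ-endLevel-bwds-≤ i a (m∸n≤m (toℕ a) (toℕ q))) (sym q+i≡a)))

excursion⁺ excursion⁻ : ℕ → List Move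
excursion⁺ k = fwds k ++ bwds k
excursion⁻ k = bwds k ++ fwds k

endLevel-excursion⁺ : ∀ k (a : Fin (suc n)) → endLevel a (excursion⁺ k) ≡ a
endLevel-excursion⁺ k a = trans (endLevel-++ a (fwds k) (bwds k)) (fwds-bwds-cancel k a)

endLevel-excursion⁻ : ∀ k (a : Fin (suc n)) → endLevel a (excursion⁻ k) ≡ a
endLevel-excursion⁻ k a = trans (endLevel-++ a (bwds k) (fwds k)) (bwds-fwds-cancel k a)

endLevel-loop : ∀ (a : Fin (suc n)) → endLevel a (fwds (suc n)) ≡ a
endLevel-loop {n} a = endLevel-fwds (suc n) a a
  (trans ([m+n]%n≡m%n (toℕ a) (suc n)) (m<n⇒m%n≡m (Fin.toℕ<n a)))

∈-visited-loop : ∀ (q : Fin (suc n)) → q ∈ visited zero (fwds (suc n))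
∈-visited-loop q = ∈-visited-fwds⁺ ≤-refl z≤n (Fin.toℕ<n q)

toℕ-next-zero : 1 ≤ n → toℕ (next (zero {n})) ≡ 1
toℕ-next-zero 1≤n = toℕ-next-< zero (s≤s 1≤n)

zero∉visited-loop : 1 ≤ n → zero ∉ visited (next zero) (fwds n)
zero∉visited-loop {n} 1≤n z∈ with ∈-visited-fwds⁻ (≤-reflexive (cong (_+ n) (toℕ-next-zero 1≤n))) z∈
... | next0≤0 , _ = contradiction (subst (_≤ 0) (toℕ-next-zero 1≤n) next0≤0) λ ()

module _ {t : ℕ} (t<n : suc t ≤ n) where

  private
    peak : Fin (suc n)
    peak = endLevel zero (fwds (suc t))

    toℕ-peak : toℕ peak ≡ suc t
    toℕ-peak = toℕ-endLevel-fwds-< (suc t) zero (s≤s t<n)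

  ∈-visited-excursion⁺ : ∀ (q : Fin (suc n)) → toℕ q ≤ suc t → q ∈ visited zero (excursion⁺ (suc t))
  ∈-visited-excursion⁺ zero _ = here refl
  ∈-visited-excursion⁺ q@(suc _) q≤ = subst (q ∈_) (sym (visited-++ zero (fwds (suc t)) (bwds (suc t)))) $
    ∈.∈-++⁺ʳ (visited zero (fwds (suc t)))
      (∈-visited-bwds⁺ (≤-reflexive (sym toℕ-peak)) (subst (toℕ q ≤_) (sym toℕ-peak) q≤)
        (subst (_< toℕ q + suc t) (sym toℕ-peak) (m<n+m (suc t) z<s)))

  ∈-visited-excursion⁺⁻ : ∀ {q : Fin (suc n)} → q ∈ visited zero (excursion⁺ (suc t)) → toℕ q ≤ suc t
  ∈-visited-excursion⁺⁻ {q} q∈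
    with ∈.∈-++⁻ (visited zero (fwds (suc t)))
      (subst (q ∈_) (visited-++ zero (fwds (suc t)) (bwds (suc t))) q∈)
  ... | inj₁ q∈f = <⇒≤ (proj₂ (∈-visited-fwds⁻ (≤-trans t<n (n≤1+n n)) q∈f))
  ... | inj₂ q∈b = subst (toℕ q ≤_) toℕ-peak (proj₁ (∈-visited-bwds⁻ (≤-reflexive (sym toℕ-peak)) q∈b))

  zero∉visited-excursion⁺ : zero ∉ visited (next zero) (fwds t ++ bwds (suc t))
  zero∉visited-excursion⁺ z∈
    with ∈.∈-++⁻ (visited (next zero) (fwds t))
      (subst (zero ∈_) (visited-++ (next zero) (fwds t) (bwds (suc t))) z∈)
  ... | inj₁ z∈f = contradiction (subst (_≤ 0) next0≡1 (proj₁ (∈-visited-fwds⁻ 1+t≤D z∈f))) λ ()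
    where
    next0≡1 : toℕ (next (zero {n})) ≡ 1
    next0≡1 = toℕ-next-zero (≤-trans (s≤s z≤n) t<n)
    1+t≤D : toℕ (next zero) + t ≤ suc n
    1+t≤D = subst (λ z → z + t ≤ suc n) (sym next0≡1) (s≤s (≤-trans (n≤1+n t) t<n))
  ... | inj₂ z∈b = <-irrefl refl
      (subst (_< suc t) toℕ-peak (proj₂ (∈-visited-bwds⁻ (≤-reflexive (sym toℕ-peak)) z∈b)))

module _ {e : ℕ} (e≤n : e ≤ n) where

  private
    trough : Fin (suc n)
    trough = endLevel (prev zero) (bwds e)

    toℕ-trough : toℕ trough + e ≡ n
    toℕ-trough = trans (toℕ-endLevel-bwds-≤ e (prev zero) (subst (e ≤_) (sym toℕ-prev-zero) e≤n))
      toℕ-prev-zero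

    trough+e+1≡D : toℕ trough + suc e ≡ suc n
    trough+e+1≡D = trans (+-suc _ e) (cong suc toℕ-trough)

  ∈-visited-excursion⁻ : ∀ (q : Fin (suc n)) → n ≤ toℕ q + e → q ∈ visited zero (excursion⁻ (suc e))
  ∈-visited-excursion⁻ q n≤q+e = there $ subst (q ∈_) (sym (visited-++ (prev zero) (bwds e) (fwds (suc e)))) $
    ∈.∈-++⁺ʳ (visited (prev zero) (bwds e))
      (∈-visited-fwds⁺ (≤-reflexive trough+e+1≡D)
        (+-cancelʳ-≤ e _ _ (subst (_≤ toℕ q + e) (sym toℕ-trough) n≤q+e))
        (subst (toℕ q <_) (sym trough+e+1≡D) (Fin.toℕ<n q)))

  zero∉visited-excursion⁻ : e < n → zero ∉ visited (prev zero) (bwds e ++ fwds (suc e))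
  zero∉visited-excursion⁻ e<n z∈
    with ∈.∈-++⁻ (visited (prev zero) (bwds e))
      (subst (zero ∈_) (visited-++ (prev zero) (bwds e) (fwds (suc e))) z∈)
  ... | inj₁ z∈b = <⇒≱ (subst (_< e) toℕ-prev-zero
      (proj₂ (∈-visited-bwds⁻ (subst (e ≤_) (sym toℕ-prev-zero) e≤n) z∈b))) e≤n
  ... | inj₂ z∈f = <⇒≢ e<n (trans (sym (+-identityˡ e)) (trans (cong (_+ e) (sym trough≡0)) toℕ-trough))
    where
    trough≡0 : toℕ trough ≡ 0
    trough≡0 = n≤0⇒n≡0 (proj₁ (∈-visited-fwds⁻ (≤-reflexive trough+e+1≡D) z∈f))

length-excursion⁺ : ∀ k → length (excursion⁺ k) ≡ k + k
length-excursion⁺ k = trans (length-++ (fwds k)) (cong₂ _+_ (length-replicate k) (length-replicate k))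

length-excursion⁻ : ∀ k → length (excursion⁻ k) ≡ k + k
length-excursion⁻ k = trans (length-++ (bwds k)) (cong₂ _+_ (length-replicate k) (length-replicate k))

cycleWalk : ∀ (ℓ : Fin (suc n)) y ms → Walk (suc n) (ℓ , y) (endLevel ℓ ms , y)
cycleWalk ℓ y [] = []
cycleWalk ℓ y (m ∷ ms) = inj₁ (refl , step-cycNext m ℓ) ∷ cycleWalk (step m ℓ) y ms

len-cycleWalk : ∀ (ℓ : Fin (suc n)) y ms → len (cycleWalk ℓ y ms) ≡ length ms
len-cycleWalk ℓ y [] = refl
len-cycleWalk ℓ y (m ∷ ms) = cong suc (len-cycleWalk (step m ℓ) y ms)

δ : Fin (suc n) → Fin (suc n) → ℕ
δ {n} a b = ∣ toℕ a - toℕ b ∣ ⊓ (suc n ∸ ∣ toℕ a - toℕ b ∣)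

δ-refl : ∀ (a : Fin (suc n)) → δ a a ≡ 0
δ-refl a rewrite ∣n-n∣≡0 (toℕ a) = refl

δ-sym : ∀ (a b : Fin (suc n)) → δ a b ≡ δ b a
δ-sym a b rewrite ∣-∣-comm (toℕ a) (toℕ b) = refl

endLevel-fwds-upward : ∀ (a b : Fin (suc n)) → toℕ a ≤ toℕ b →
  endLevel a (fwds (toℕ b ∸ toℕ a)) ≡ b
endLevel-fwds-upward a b a≤b =
  endLevel-fwds _ a b (trans (cong (_% _) (m+[n∸m]≡n a≤b)) (m<n⇒m%n≡m (Fin.toℕ<n b)))

endLevel-fwds-around : ∀ (a b : Fin (suc n)) → toℕ b ≤ toℕ a →
  endLevel a (fwds (suc n ∸ (toℕ a ∸ toℕ b))) ≡ b
endLevel-fwds-around {n} a b b≤a = endLevel-fwds _ a b (begin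
  (A + (suc n ∸ (A ∸ B))) % suc n
    ≡⟨ cong (λ z → (z + (suc n ∸ (A ∸ B))) % suc n) (m+[n∸m]≡n b≤a) ⟨
  (B + (A ∸ B) + (suc n ∸ (A ∸ B))) % suc n    ≡⟨ cong (_% suc n) (+-assoc B (A ∸ B) _) ⟩
  (B + ((A ∸ B) + (suc n ∸ (A ∸ B)))) % suc n  ≡⟨ cong (λ z → (B + z) % suc n) (m+[n∸m]≡n A∸B≤D) ⟩
  (B + suc n) % suc n                          ≡⟨ [m+n]%n≡m%n B (suc n) ⟩
  B % suc n                                    ≡⟨ m<n⇒m%n≡m (Fin.toℕ<n b) ⟩
  B                                            ∎)
  where
  open ≡-Reasoning
  A B : ℕ
  A = toℕ a
  B = toℕ b
  A∸B≤D : A ∸ B ≤ suc n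
  A∸B≤D = ≤-trans (m∸n≤m A B) (<⇒≤ (Fin.toℕ<n a))

δ-moves : ∀ (a b : Fin (suc n)) → Σ (List Move) λ ms → endLevel a ms ≡ b × length ms ≡ δ a b
δ-moves {n} a b with ≤-total (toℕ a) (toℕ b) | ⊓-sel ∣ toℕ a - toℕ b ∣ (suc n ∸ ∣ toℕ a - toℕ b ∣)
... | inj₁ a≤b | inj₁ e = fwds (toℕ b ∸ toℕ a) , endLevel-fwds-upward a b a≤b ,
  trans (length-replicate _) (sym (trans e (trans (∣-∣-comm (toℕ a) _) (m≤n⇒∣n-m∣≡n∸m a≤b))))
... | inj₁ a≤b | inj₂ e = bwds (suc n ∸ (toℕ b ∸ toℕ a)) ,
  bwds-retraces-fwds (suc n ∸ (toℕ b ∸ toℕ a)) a b (endLevel-fwds-around b a a≤b) ,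
  trans (length-replicate _)
    (sym (trans e (cong (suc n ∸_) (trans (∣-∣-comm (toℕ a) _) (m≤n⇒∣n-m∣≡n∸m a≤b)))))
... | inj₂ b≤a | inj₁ e = bwds (toℕ a ∸ toℕ b) , bwds-retraces-fwds (toℕ a ∸ toℕ b) a b
    (endLevel-fwds-upward b a b≤a) ,
  trans (length-replicate _) (sym (trans e (m≤n⇒∣n-m∣≡n∸m b≤a)))
... | inj₂ b≤a | inj₂ e = fwds (suc n ∸ (toℕ a ∸ toℕ b)) , endLevel-fwds-around a b b≤a ,
  trans (length-replicate _) (sym (trans e (cong (suc n ∸_) (m≤n⇒∣n-m∣≡n∸m b≤a))))

δ-walk : ∀ (a b : Fin (suc n)) y → Σ (Walk (suc n) (a , y) (b , y)) λ p → len p ≡ δ a b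
δ-walk a b y with δ-moves a b
... | ms , refl , ms≡δ = cycleWalk a y ms , trans (len-cycleWalk a y ms) ms≡δ

∣m-1+m∣≡1 : ∀ m → ∣ m - suc m ∣ ≡ 1
∣m-1+m∣≡1 zero = refl
∣m-1+m∣≡1 (suc m) = ∣m-1+m∣≡1 m

∸-suc-≤ : ∀ m t → m ∸ t ≤ suc (m ∸ suc t)
∸-suc-≤ zero t rewrite 0∸n≡0 t = z≤n
∸-suc-≤ (suc m) zero = ≤-refl
∸-suc-≤ (suc m) (suc t) = ∸-suc-≤ m t

⊓-∸-lip : ∀ D {t t′} → t ≤ suc t′ → t′ ≤ suc t → t ⊓ (D ∸ t) ≤ suc (t′ ⊓ (D ∸ t′))
⊓-∸-lip D {t} p q = ⊓-mono-≤ p (≤-trans (∸-suc-≤ D t) (s≤s (∸-monoʳ-≤ D q)))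

⊓-swap-lip : ∀ t t′ → t ⊓ suc t′ ≤ suc (t′ ⊓ suc t)
⊓-swap-lip t t′ = ⊓-glb (m⊓n≤n t (suc t′)) (≤-trans (m⊓n≤m t (suc t′)) (≤-trans (n≤1+n t) (n≤1+n (suc t))))

δ-cycNext : ∀ {a a′ : Fin (suc n)} → CycNext a a′ → ∀ b → δ a b ≤ suc (δ a′ b) × δ a′ b ≤ suc (δ a b)
δ-cycNext {n} {a} {a′} (inj₁ a+1≡a′) b rewrite sym a+1≡a′ = ⊓-∸-lip (suc n) t≤ t′≤ , ⊓-∸-lip (suc n) t′≤ t≤
  where
  A B : ℕ
  A = toℕ a
  B = toℕ b
  t≤ : ∣ A - B ∣ ≤ suc ∣ suc A - B ∣
  t≤ = subst (λ z → ∣ A - B ∣ ≤ z + ∣ suc A - B ∣) (∣m-1+m∣≡1 A) (∣-∣-triangle A (suc A) B)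
  t′≤ : ∣ suc A - B ∣ ≤ suc ∣ A - B ∣
  t′≤ = subst (λ z → ∣ suc A - B ∣ ≤ z + ∣ A - B ∣) (trans (∣-∣-comm (suc A) A) (∣m-1+m∣≡1 A))
          (∣-∣-triangle (suc A) A B)
δ-cycNext {n} {a} {a′} (inj₂ (a+1≡D , a′≡0)) b =
  subst₂ (λ x y → x ≤ suc y) (sym δa) (sym δa′) (⊓-swap-lip (n ∸ B) B) ,
  subst₂ (λ x y → x ≤ suc y) (sym δa′) (sym δa) (⊓-swap-lip B (n ∸ B))
  where
  B : ℕ
  B = toℕ b
  B≤n : B ≤ n
  B≤n = s≤s⁻¹ (Fin.toℕ<n b)
  ∣a-b∣ : ∣ toℕ a - B ∣ ≡ n ∸ B
  ∣a-b∣ = trans (cong (λ z → ∣ z - B ∣) (suc-injective a+1≡D)) (m≤n⇒∣n-m∣≡n∸m B≤n)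
  δa : δ a b ≡ (n ∸ B) ⊓ suc B
  δa = trans (cong (λ z → z ⊓ (suc n ∸ z)) ∣a-b∣)
         (cong ((n ∸ B) ⊓_) (trans (+-∸-assoc 1 (m∸n≤m n B)) (cong suc (m∸[m∸n]≡n B≤n))))
  δa′ : δ a′ b ≡ B ⊓ suc (n ∸ B)
  δa′ = trans (cong (λ z → ∣ z - B ∣ ⊓ (suc n ∸ ∣ z - B ∣)) a′≡0) (cong (B ⊓_) (+-∸-assoc 1 B≤n))

δ-adj : ∀ {u w : Vertex (suc n)} → Adj (suc n) u w → ∀ b → δ (proj₁ u) b ≤ suc (δ (proj₁ w) b)
δ-adj (inj₁ (_ , inj₁ c)) b = proj₁ (δ-cycNext c b)
δ-adj (inj₁ (_ , inj₂ c)) b = proj₂ (δ-cycNext c b)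
δ-adj (inj₂ (refl , _)) b = n≤1+n _

δ≤len : ∀ {u : Vertex (suc n)} c y (p : Walk (suc n) u (c , y)) → δ (proj₁ u) c ≤ len p
δ≤len c y p = lipschitz⇒potential≤len (λ v → δ (proj₁ v) c) (λ e → δ-adj e c) (δ-refl c) p

δ-triangle : ∀ (a b c : Fin (suc n)) → δ a c ≤ δ a b + δ b c
δ-triangle {n} a b c with δ-walk a b (Vec.replicate (suc n) false) | δ-walk b c (Vec.replicate (suc n) false)
... | p , p≡ | q , q≡ = subst (δ a c ≤_) (trans (len-++ʷ p q) (cong₂ _+_ p≡ q≡)) (δ≤len c _ (p ++ʷ q))

≤-δ : ∀ {s} (a b : Fin (suc n)) → s ≤ ∣ toℕ a - toℕ b ∣ → s ≤ suc n ∸ ∣ toℕ a - toℕ b ∣ → s ≤ δ a b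
≤-δ a b = ⊓-glb

infix 4 _≟ᵇ_
_≟ᵇ_ : DecidableEquality (Vec Bool n)
_≟ᵇ_ = ≡-dec Bool._≟_

lookup-extensionality : ∀ (y x : Vec Bool n) → (∀ p → lookup y p ≡ lookup x p) → y ≡ x
lookup-extensionality y x h = begin
  y                ≡⟨ tabulate∘lookup y ⟨
  tabulate (lookup y)  ≡⟨ tabulate-cong h ⟩
  tabulate (lookup x)  ≡⟨ tabulate∘lookup x ⟩
  x                ∎
  where open ≡-Reasoning

lookup-flipBit : ∀ (y : Vec Bool n) ℓ → lookup (flipBit y ℓ) ℓ ≡ not (lookup y ℓ)
lookup-flipBit y ℓ = lookup∘updateAt ℓ y

lookup-flipBit-other : ∀ (y : Vec Bool n) {ℓ p} → p ≢ ℓ → lookup (flipBit y ℓ) p ≡ lookup y p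
lookup-flipBit-other y {ℓ} {p} p≢ℓ = lookup∘updateAt′ p ℓ p≢ℓ y

flipBit-involutive : ∀ (y : Vec Bool n) ℓ → flipBit (flipBit y ℓ) ℓ ≡ y
flipBit-involutive y ℓ = trans (updateAt-updateAt ℓ y)
  (trans (updateAt-cong ℓ not-involutive y) (updateAt-id ℓ y))

hamming : Vec Bool n → Vec Bool n → ℕ
hamming [] [] = 0
hamming (a ∷ y) (b ∷ x) = (if a xor b then 1 else 0) + hamming y x

hamming-self : ∀ (x : Vec Bool n) → hamming x x ≡ 0
hamming-self [] = refl
hamming-self (false ∷ x) = hamming-self x
hamming-self (true ∷ x) = hamming-self x

hamming≡0⇒≡ : ∀ (y x : Vec Bool n) → hamming y x ≡ 0 → y ≡ x
hamming≡0⇒≡ [] [] _ = refl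
hamming≡0⇒≡ (false ∷ y) (false ∷ x) h = cong (false ∷_) (hamming≡0⇒≡ y x h)
hamming≡0⇒≡ (true ∷ y) (true ∷ x) h = cong (true ∷_) (hamming≡0⇒≡ y x h)

hamming-flip-agreeing : ∀ (y x : Vec Bool n) ℓ → lookup y ℓ ≡ lookup x ℓ →
  hamming (flipBit y ℓ) x ≡ suc (hamming y x)
hamming-flip-agreeing (false ∷ y) (false ∷ x) zero _ = refl
hamming-flip-agreeing (true ∷ y) (true ∷ x) zero _ = refl
hamming-flip-agreeing (a ∷ y) (b ∷ x) (suc ℓ) e =
  trans (cong (_ +_) (hamming-flip-agreeing y x ℓ e)) (+-suc _ (hamming y x))

hamming-flip-disagreeing : ∀ (y x : Vec Bool n) ℓ → lookup y ℓ ≢ lookup x ℓ →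
  hamming y x ≡ suc (hamming (flipBit y ℓ) x)
hamming-flip-disagreeing (false ∷ y) (false ∷ x) zero ne = contradiction refl ne
hamming-flip-disagreeing (true ∷ y) (true ∷ x) zero ne = contradiction refl ne
hamming-flip-disagreeing (false ∷ y) (true ∷ x) zero _ = refl
hamming-flip-disagreeing (true ∷ y) (false ∷ x) zero _ = refl
hamming-flip-disagreeing (a ∷ y) (b ∷ x) (suc ℓ) ne =
  trans (cong (_ +_) (hamming-flip-disagreeing y x ℓ ne)) (+-suc _ _)

hamming-flip : ∀ (y x : Vec Bool n) ℓ →
  hamming (flipBit y ℓ) x ≡ suc (hamming y x) ⊎ hamming y x ≡ suc (hamming (flipBit y ℓ) x)
hamming-flip y x ℓ with lookup y ℓ Bool.≟ lookup x ℓ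
... | yes e = inj₁ (hamming-flip-agreeing y x ℓ e)
... | no ne = inj₂ (hamming-flip-disagreeing y x ℓ ne)

-- A lower bound for the distance from [ℓ, y] to [τ, x′]: every bit in which y and x′
-- differ costs a flip, and the levels i and j must be visited if their bits differ.
module DistanceBound (τ : Fin (suc n)) (x′ : Vec Bool (suc n)) (i j : Fin (suc n)) where

  -- length of a shortest tour along the cycle from ℓ to τ that visits i if vi holds
  -- and j if vj holds
  tour : Fin (suc n) → Bool → Bool → ℕ
  tour ℓ false false = δ ℓ τ
  tour ℓ true false = δ ℓ i + δ i τ
  tour ℓ false true = δ ℓ j + δ j τ
  tour ℓ true true = (δ ℓ i + δ i j + δ j τ) ⊓ (δ ℓ j + δ j i + δ i τ)

  differs : Vec Bool (suc n) → Fin (suc n) → Bool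
  differs y p = lookup y p xor lookup x′ p

  bound : Vertex (suc n) → ℕ
  bound (ℓ , y) = hamming y x′ + tour ℓ (differs y i) (differs y j)

  tour-adj : ∀ {u w : Vertex (suc n)} → Adj (suc n) u w → ∀ vi vj →
    tour (proj₁ u) vi vj ≤ suc (tour (proj₁ w) vi vj)
  tour-adj e false false = δ-adj e τ
  tour-adj e true false = +-monoˡ-≤ _ (δ-adj e i)
  tour-adj e false true = +-monoˡ-≤ _ (δ-adj e j)
  tour-adj e true true = ⊓-mono-≤ (+-monoˡ-≤ (δ j τ) (+-monoˡ-≤ (δ i j) (δ-adj e i)))
                                  (+-monoˡ-≤ (δ i τ) (+-monoˡ-≤ (δ j i) (δ-adj e j)))

  tour-at-i : ∀ vi vj → tour i vi vj ≡ tour i false vj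
  tour-at-i false vj = refl
  tour-at-i true false = cong (_+ δ i τ) (δ-refl i)
  tour-at-i true true = begin
    (δ i i + δ i j + δ j τ) ⊓ (δ i j + δ j i + δ i τ)
      ≡⟨ cong (λ z → (z + δ i j + δ j τ) ⊓ (δ i j + δ j i + δ i τ)) (δ-refl i) ⟩
    (δ i j + δ j τ) ⊓ (δ i j + δ j i + δ i τ)        ≡⟨ m≤n⇒m⊓n≡m via-j ⟩
    δ i j + δ j τ                                    ∎
    where
    open ≡-Reasoning
    via-j : δ i j + δ j τ ≤ δ i j + δ j i + δ i τ
    via-j = ≤-trans (+-monoʳ-≤ (δ i j) (δ-triangle j i τ)) (≤-reflexive (sym (+-assoc (δ i j) _ _)))

  tour-at-j : ∀ vi vj → tour j vi vj ≡ tour j vi false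
  tour-at-j vi false = refl
  tour-at-j false true = cong (_+ δ j τ) (δ-refl j)
  tour-at-j true true = begin
    (δ j i + δ i j + δ j τ) ⊓ (δ j j + δ j i + δ i τ)
      ≡⟨ cong (λ z → (δ j i + δ i j + δ j τ) ⊓ (z + δ j i + δ i τ)) (δ-refl j) ⟩
    (δ j i + δ i j + δ j τ) ⊓ (δ j i + δ i τ)        ≡⟨ m≥n⇒m⊓n≡n via-i ⟩
    δ j i + δ i τ                                    ∎
    where
    open ≡-Reasoning
    via-i : δ j i + δ i τ ≤ δ j i + δ i j + δ j τ
    via-i = ≤-trans (+-monoʳ-≤ (δ j i) (δ-triangle i j τ)) (≤-reflexive (sym (+-assoc (δ j i) _ _)))

  tour-ignores-current : ∀ ℓ {vi vj vi′ vj′} → (i ≢ ℓ → vi ≡ vi′) → (j ≢ ℓ → vj ≡ vj′) →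
    tour ℓ vi vj ≡ tour ℓ vi′ vj′
  tour-ignores-current ℓ {vi} {vj} {vi′} {vj′} hi hj with i Fin.≟ ℓ | j Fin.≟ ℓ
  ... | no i≢ℓ | no j≢ℓ = cong₂ (tour ℓ) (hi i≢ℓ) (hj j≢ℓ)
  ... | yes refl | no j≢ℓ =
    trans (tour-at-i vi vj) (trans (cong (tour i false) (hj j≢ℓ)) (sym (tour-at-i vi′ vj′)))
  ... | no i≢ℓ | yes refl =
    trans (tour-at-j vi vj) (trans (cong (λ v → tour j v false) (hi i≢ℓ)) (sym (tour-at-j vi′ vj′)))
  ... | yes refl | yes refl =
    trans (tour-at-i vi vj)
      (trans (tour-at-j false vj) (sym (trans (tour-at-i vi′ vj′) (tour-at-j false vj′))))

  differs-flipBit : ∀ y {ℓ p} → p ≢ ℓ → differs (flipBit y ℓ) p ≡ differs y p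
  differs-flipBit y {ℓ} {p} p≢ℓ = cong (_xor lookup x′ p) (lookup-flipBit-other y p≢ℓ)

  bound-adj : ∀ {u w} → Adj (suc n) u w → bound u ≤ suc (bound w)
  bound-adj {ℓ , y} {ℓ′ , .y} e@(inj₁ (refl , _)) =
    ≤-trans (+-monoʳ-≤ (hamming y x′) (tour-adj e (differs y i) (differs y j))) (≤-reflexive (+-suc _ _))
  bound-adj {ℓ , y} (inj₂ (refl , refl)) =
    subst (λ t → hamming y x′ + tour ℓ (differs y i) (differs y j) ≤ suc (hamming (flipBit y ℓ) x′ + t))
      (sym same-tour) (off-by-one (hamming-flip y x′ ℓ))
    where
    same-tour : tour ℓ (differs (flipBit y ℓ) i) (differs (flipBit y ℓ) j) ≡ tour ℓ (differs y i)
      (differs y j)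
    same-tour = tour-ignores-current ℓ (differs-flipBit y) (differs-flipBit y)
    off-by-one : ∀ {h h′ t} → h′ ≡ suc h ⊎ h ≡ suc h′ → h + t ≤ suc (h′ + t)
    off-by-one (inj₁ refl) = ≤-trans (n≤1+n _) (n≤1+n _)
    off-by-one (inj₂ refl) = ≤-refl

  bound-target : bound (τ , x′) ≡ 0
  bound-target = begin
    hamming x′ x′ + tour τ (differs x′ i) (differs x′ j)
      ≡⟨ cong₂ (λ h v → h + tour τ v (differs x′ j)) (hamming-self x′) (xor-same (lookup x′ i)) ⟩
    tour τ false (differs x′ j)                        ≡⟨ cong (tour τ false) (xor-same (lookup x′ j)) ⟩
    δ τ τ                                             ≡⟨ δ-refl τ ⟩
    0                                                 ∎
    where open ≡-Reasoning

  bound≤len : ∀ {u v} → v ≡ (τ , x′) → (p : Walk (suc n) u v) → bound u ≤ len p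
  bound≤len refl p = lipschitz⇒potential≤len bound bound-adj bound-target p

  shortest-if-≤bound : ∀ {u v} → v ≡ (τ , x′) → (p : Walk (suc n) u v) → len p ≤ bound u → IsShortest p
  shortest-if-≤bound eq p p≤ q = ≤-trans p≤ (bound≤len eq q)

  visible-if-≤bound : ∀ (X : List (Vertex (suc n))) {u v} → v ≡ (τ , x′) → (p : Walk (suc n) u v) →
    All (_∉ X) (internal p) → len p ≤ bound u → Visible (suc n) X u (τ , x′)
  visible-if-≤bound X eq p avoids p≤ = subst (Visible (suc n) X _) eq
    (p , shortest-if-≤bound eq p p≤ , avoids)

  differs-≢ : ∀ y {p} → lookup y p ≢ lookup x′ p → differs y p ≡ true
  differs-≢ y {p} ne with lookup y p | lookup x′ p
  ... | false | false = contradiction refl ne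
  ... | false | true = refl
  ... | true | false = refl
  ... | true | true = contradiction refl ne

  ≤-tour-round : ∀ {a b c} → a ≤ δ τ i → b ≤ δ i j → c ≤ δ τ j → a + b + c ≤ tour τ true true
  ≤-tour-round {a} {b} {c} a≤ b≤ c≤ = ⊓-glb
    (+-mono-≤ (+-mono-≤ a≤ b≤) (subst (c ≤_) (δ-sym τ j) c≤))
    (≤-trans (≤-reflexive (xy∙z≈zy∙x a b c))
      (+-mono-≤ (+-mono-≤ c≤ (subst (b ≤_) (δ-sym i j) b≤)) (subst (a ≤_) (δ-sym τ i) a≤)))

module Routes (x′ : Vec Bool (suc n)) where

  fix : Fin (suc n) → Vec Bool (suc n) → Vec Bool (suc n)
  fix ℓ y with lookup y ℓ Bool.≟ lookup x′ ℓ
  ... | yes _ = y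
  ... | no _ = flipBit y ℓ

  fixWalk : ∀ ℓ y → Walk (suc n) (ℓ , y) (ℓ , fix ℓ y)
  fixWalk ℓ y with lookup y ℓ Bool.≟ lookup x′ ℓ
  ... | yes _ = []
  ... | no _ = inj₂ (refl , refl) ∷ []

  endBits : Fin (suc n) → Vec Bool (suc n) → List Move → Vec Bool (suc n)
  endBits ℓ y [] = y
  endBits ℓ y (m ∷ ms) = endBits (step m ℓ) (fix ℓ y) ms

  route : ∀ ℓ y ms → Walk (suc n) (ℓ , y) (endLevel ℓ ms , endBits ℓ y ms)
  route ℓ y [] = []
  route ℓ y (m ∷ ms) = fixWalk ℓ y ++ʷ (inj₁ (refl , step-cycNext m ℓ) ∷ route (step m ℓ) (fix ℓ y) ms)

  len-fixWalk : ∀ ℓ y → len (fixWalk ℓ y) + hamming (fix ℓ y) x′ ≡ hamming y x′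
  len-fixWalk ℓ y with lookup y ℓ Bool.≟ lookup x′ ℓ
  ... | yes _ = refl
  ... | no ne = sym (hamming-flip-disagreeing y x′ ℓ ne)

  len-route : ∀ ℓ y ms → len (route ℓ y ms) + hamming (endBits ℓ y ms) x′ ≡ length ms + hamming y x′
  len-route ℓ y [] = refl
  len-route ℓ y (m ∷ ms) = begin
    len (fixWalk ℓ y ++ʷ (e ∷ r)) + h-end         ≡⟨ cong (_+ h-end) (len-++ʷ (fixWalk ℓ y) (e ∷ r)) ⟩
    len (fixWalk ℓ y) + suc (len r) + h-end       ≡⟨ +-assoc (len (fixWalk ℓ y)) _ _ ⟩
    len (fixWalk ℓ y) + suc (len r + h-end)
      ≡⟨ cong (λ z → len (fixWalk ℓ y) + suc z) (len-route (step m ℓ) y′ ms) ⟩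
    len (fixWalk ℓ y) + suc (length ms + h′)      ≡⟨ +-suc _ _ ⟩
    suc (len (fixWalk ℓ y) + (length ms + h′))    ≡⟨ cong suc (x∙yz≈y∙xz (len (fixWalk ℓ y)) (length ms) h′) ⟩
    suc (length ms + (len (fixWalk ℓ y) + h′))    ≡⟨ cong (λ z → suc (length ms + z)) (len-fixWalk ℓ y) ⟩
    suc (length ms + hamming y x′)                ∎
    where
    open ≡-Reasoning
    y′ : Vec Bool (suc n)
    y′ = fix ℓ y
    e : Adj (suc n) (ℓ , y′) (step m ℓ , y′)
    e = inj₁ (refl , step-cycNext m ℓ)
    r : Walk (suc n) (step m ℓ , y′) (endLevel (step m ℓ) ms , endBits (step m ℓ) y′ ms)
    r = route (step m ℓ) y′ ms
    h-end h′ : ℕ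
    h-end = hamming (endBits (step m ℓ) y′ ms) x′
    h′ = hamming y′ x′

  len-route-to-target : ∀ ℓ y ms → endBits ℓ y ms ≡ x′ → len (route ℓ y ms) ≡ length ms + hamming y x′
  len-route-to-target ℓ y ms reaches = begin
    len (route ℓ y ms)                               ≡⟨ +-identityʳ _ ⟨
    len (route ℓ y ms) + 0
      ≡⟨ cong (len (route ℓ y ms) +_)
        (trans (sym (hamming-self x′)) (cong (λ z → hamming z x′) (sym reaches))) ⟩
    len (route ℓ y ms) + hamming (endBits ℓ y ms) x′ ≡⟨ len-route ℓ y ms ⟩
    length ms + hamming y x′                         ∎
    where open ≡-Reasoning

  lookup-fix : ∀ ℓ y → lookup (fix ℓ y) ℓ ≡ lookup x′ ℓ
  lookup-fix ℓ y with lookup y ℓ Bool.≟ lookup x′ ℓ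
  ... | yes e = e
  ... | no ne = trans (lookup-flipBit y ℓ) (sym (¬-not (ne ∘ sym)))

  lookup-fix-other : ∀ ℓ y {p} → p ≢ ℓ → lookup (fix ℓ y) p ≡ lookup y p
  lookup-fix-other ℓ y p≢ℓ with lookup y ℓ Bool.≟ lookup x′ ℓ
  ... | yes _ = refl
  ... | no _ = lookup-flipBit-other y p≢ℓ

  fix-preserves-agreement : ∀ ℓ y p → lookup y p ≡ lookup x′ p → lookup (fix ℓ y) p ≡ lookup x′ p
  fix-preserves-agreement ℓ y p e with p Fin.≟ ℓ
  ... | yes refl = lookup-fix ℓ y
  ... | no p≢ℓ = trans (lookup-fix-other ℓ y p≢ℓ) e

  endBits-preserves-agreement : ∀ ℓ y ms p → lookup y p ≡ lookup x′ p → lookup (endBits ℓ y ms) p ≡ lookup x′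
    p
  endBits-preserves-agreement ℓ y [] p e = e
  endBits-preserves-agreement ℓ y (m ∷ ms) p e =
    endBits-preserves-agreement (step m ℓ) (fix ℓ y) ms p (fix-preserves-agreement ℓ y p e)

  lookup-endBits-visited : ∀ ℓ y ms p → p ∈ visited ℓ ms → lookup (endBits ℓ y ms) p ≡ lookup x′ p
  lookup-endBits-visited ℓ y (m ∷ ms) p (here refl) = endBits-preserves-agreement (step m ℓ) (fix ℓ y) ms p
    (lookup-fix ℓ y)
  lookup-endBits-visited ℓ y (m ∷ ms) p (there p∈) = lookup-endBits-visited (step m ℓ) (fix ℓ y) ms p p∈

  lookup-endBits-unvisited : ∀ ℓ y ms p → p ∉ visited ℓ ms → lookup (endBits ℓ y ms) p ≡ lookup y p
  lookup-endBits-unvisited ℓ y [] p _ = refl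
  lookup-endBits-unvisited ℓ y (m ∷ ms) p p∉ =
    trans (lookup-endBits-unvisited (step m ℓ) (fix ℓ y) ms p (p∉ ∘ there)) (lookup-fix-other ℓ y (p∉ ∘ here))

  level-initVerts-route : ∀ ℓ y ms {v} → v ∈ initVerts (route ℓ y ms) → proj₁ v ∈ visited ℓ ms
  level-initVerts-route ℓ y (m ∷ ms) v∈
    rewrite initVerts-++ʷ (fixWalk ℓ y) (inj₁ (refl , step-cycNext m ℓ) ∷ route (step m ℓ) (fix ℓ y) ms)
    with ∈.∈-++⁻ (initVerts (fixWalk ℓ y)) v∈
  ... | inj₁ v∈fix = here (level-fixWalk ℓ y v∈fix)
    where
    level-fixWalk : ∀ ℓ y {v} → v ∈ initVerts (fixWalk ℓ y) → proj₁ v ≡ ℓ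
    level-fixWalk ℓ y v∈ with lookup y ℓ Bool.≟ lookup x′ ℓ
    level-fixWalk ℓ y (here refl) | no _ = refl
  ... | inj₂ (here refl) = here refl
  ... | inj₂ (there v∈r) = there (level-initVerts-route (step m ℓ) (fix ℓ y) ms v∈r)

  All-internal-route : ∀ (P : Vertex (suc n) → Set) ℓ y m ms →
    (lookup y ℓ ≢ lookup x′ ℓ → P (ℓ , flipBit y ℓ)) →
    (∀ {v} → v ∈ initVerts (route (step m ℓ) (fix ℓ y) ms) → P v) →
    All P (internal (route ℓ y (m ∷ ms)))
  All-internal-route P ℓ y m ms P-flipped P-rest with lookup y ℓ Bool.≟ lookup x′ ℓ
  ... | yes _ = All.tabulate P-rest
  ... | no ne = P-flipped ne ∷ All.tabulate P-rest

allBitStrings : ∀ m → List (Vec Bool m)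
allBitStrings zero = [] ∷ []
allBitStrings (suc m) = map (false ∷_) (allBitStrings m) ++ map (true ∷_) (allBitStrings m)

length-allBitStrings : ∀ m → length (allBitStrings m) ≡ 2 ^ m
length-allBitStrings zero = refl
length-allBitStrings (suc m) = begin
  length (map (false ∷_) bs ++ map (true ∷_) bs)        ≡⟨ length-++ (map (false ∷_) bs) ⟩
  length (map (false ∷_) bs) + length (map (true ∷_) bs) ≡⟨ cong₂ _+_ (length-map _ bs) (length-map _ bs) ⟩
  length bs + length bs                                  ≡⟨ cong (λ k → k + k) (length-allBitStrings m) ⟩
  2 ^ m + 2 ^ m                                          ≡⟨ cong (2 ^ m +_) (+-identityʳ (2 ^ m)) ⟨
  2 ^ suc m                                              ∎
  where
  open ≡-Reasoning
  bs : List (Vec Bool m)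
  bs = allBitStrings m

∈-allBitStrings : ∀ {m} (v : Vec Bool m) → v ∈ allBitStrings m
∈-allBitStrings [] = here refl
∈-allBitStrings (false ∷ v) = ∈.∈-++⁺ˡ (∈.∈-map⁺ (false ∷_) (∈-allBitStrings v))
∈-allBitStrings {suc m} (true ∷ v) = ∈.∈-++⁺ʳ (map (false ∷_) (allBitStrings m))
  (∈.∈-map⁺ (true ∷_) (∈-allBitStrings v))

allBitStrings-unique : ∀ m → Unique (allBitStrings m)
allBitStrings-unique zero = [] ∷ []
allBitStrings-unique (suc m) =
  Unique.++⁺ (Unique.map⁺ ∷-injectiveʳ (allBitStrings-unique m))
    (Unique.map⁺ ∷-injectiveʳ (allBitStrings-unique m)) disjoint
  where
  disjoint : ∀ {v} → ¬ (v ∈ map (false ∷_) (allBitStrings m) × v ∈ map (true ∷_) (allBitStrings m))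
  disjoint (p , q) with ∈.∈-map⁻ (false ∷_) p | ∈.∈-map⁻ (true ∷_) q
  ... | _ , _ , refl | _ , _ , ()

sum-map-+ : ∀ {A : Set} (f g : A → ℕ) xs → sum (map (λ a → f a + g a) xs) ≡ sum (map f xs) + sum (map g xs)
sum-map-+ f g [] = refl
sum-map-+ f g (a ∷ xs) = trans (cong (f a + g a +_) (sum-map-+ f g xs)) (interchange (f a) (g a) _ _)

sum-map-≤ : ∀ {A : Set} (f : A → ℕ) c xs → (∀ a → f a ≤ c) → sum (map f xs) ≤ c * length xs
sum-map-≤ f c [] _ = ≤-reflexive (sym (*-zeroʳ c))
sum-map-≤ f c (a ∷ xs) f≤c = ≤-trans (+-mono-≤ (f≤c a) (sum-map-≤ f c xs f≤c))
  (≤-reflexive (sym (*-suc c (length xs))))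

sum-map-allBitStrings-suc : ∀ m (f : Vec Bool (suc m) → ℕ) →
  sum (map f (allBitStrings (suc m))) ≡ sum (map (λ v → f (false ∷ v) + f (true ∷ v)) (allBitStrings m))
sum-map-allBitStrings-suc m f = begin
  sum (map f (map (false ∷_) bs ++ map (true ∷_) bs))
    ≡⟨ cong sum (map-++ f (map (false ∷_) bs) _) ⟩
  sum (map f (map (false ∷_) bs) ++ map f (map (true ∷_) bs))
    ≡⟨ sum-++ (map f (map (false ∷_) bs)) _ ⟩
  sum (map f (map (false ∷_) bs)) + sum (map f (map (true ∷_) bs))
    ≡⟨ cong₂ _+_ (cong sum (map-∘ bs)) (cong sum (map-∘ bs)) ⟨
  sum (map (λ v → f (false ∷ v)) bs) + sum (map (λ v → f (true ∷ v)) bs)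
    ≡⟨ sum-map-+ (λ v → f (false ∷ v)) (λ v → f (true ∷ v)) bs ⟨
  sum (map (λ v → f (false ∷ v) + f (true ∷ v)) bs)
    ∎
  where
  open ≡-Reasoning
  bs : List (Vec Bool m)
  bs = allBitStrings m

module Classes {A K : Set} (_≟ₖ_ : DecidableEquality K) (key : A → K) where

  class : K → List A → List A
  class k = filter (λ a → key a ≟ₖ k)

  private
    indicator : K → K → ℕ
    indicator k k′ = if does (k ≟ₖ k′) then 1 else 0

    length-class-∷ : ∀ k a xs → length (class k (a ∷ xs)) ≡ indicator (key a) k + length (class k xs)
    length-class-∷ k a xs with does (key a ≟ₖ k)
    ... | true = refl
    ... | false = refl

    sum-indicator-∉ : ∀ k ks → k ∉ ks → sum (map (indicator k) ks) ≡ 0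
    sum-indicator-∉ k [] _ = refl
    sum-indicator-∉ k (k′ ∷ ks) k∉ with k ≟ₖ k′
    ... | yes k≡k′ = contradiction (here k≡k′) k∉
    ... | no _ = sum-indicator-∉ k ks (k∉ ∘ there)

    sum-indicator-∈ : ∀ k ks → Unique ks → k ∈ ks → sum (map (indicator k) ks) ≡ 1
    sum-indicator-∈ k (k′ ∷ ks) (k′∉ ∷ _) _ with k ≟ₖ k′
    ... | yes refl = cong suc (sum-indicator-∉ k ks (λ k∈ → All.lookup k′∉ k∈ refl))
    sum-indicator-∈ k (k′ ∷ ks) _ (here k≡k′) | no k≢k′ = contradiction k≡k′ k≢k′
    sum-indicator-∈ k (k′ ∷ ks) (_ ∷ u) (there k∈) | no _ = sum-indicator-∈ k ks u k∈

  length≡sum-length-class : ∀ ks → Unique ks → (∀ k → k ∈ ks) → ∀ xs →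
    length xs ≡ sum (map (λ k → length (class k xs)) ks)
  length≡sum-length-class ks u complete [] = sym (all-empty ks)
    where
    all-empty : ∀ ks → sum (map (λ k → length (class k [])) ks) ≡ 0
    all-empty [] = refl
    all-empty (k ∷ ks) = all-empty ks
  length≡sum-length-class ks u complete (a ∷ xs) = begin
    suc (length xs)
      ≡⟨ cong₂ _+_ (sym (sum-indicator-∈ (key a) ks u (complete (key a))))
        (length≡sum-length-class ks u complete xs) ⟩
    sum (map (indicator (key a)) ks) + sum (map (λ k → length (class k xs)) ks)
      ≡⟨ sum-map-+ (indicator (key a)) (λ k → length (class k xs)) ks ⟨
    sum (map (λ k → indicator (key a) k + length (class k xs)) ks)
      ≡⟨ cong sum (map-cong (λ k → sym (length-class-∷ k a xs)) ks) ⟩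
    sum (map (λ k → length (class k (a ∷ xs))) ks) ∎
    where
    open ≡-Reasoning

  ∈-class⁻ : ∀ {k a} xs → a ∈ class k xs → a ∈ xs × key a ≡ k
  ∈-class⁻ xs = ∈.∈-filter⁻ (λ a → key a ≟ₖ _)

  class-unique : ∀ k xs → Unique xs → Unique (class k xs)
  class-unique k xs = Unique.filter⁺ (λ a → key a ≟ₖ k)

-- Upper bound: at most three vertices on each cycle

-- On the cycle of x, the way from l₁ to l₃ is blocked in both directions by [l₂, x]
-- and [l₄, x]; leaving the cycle to get around them costs two extra steps.
module FourLevels (x : Vec Bool (suc n)) (l₁ l₂ l₃ l₄ : Fin (suc n))
  (l₁<l₂ : toℕ l₁ < toℕ l₂) (l₂<l₃ : toℕ l₂ < toℕ l₃) (l₃<l₄ : toℕ l₃ < toℕ l₄) where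

  -- the arc of the cycle around l₁, between l₄ and l₂
  Outer : Fin (suc n) → Set
  Outer ℓ = toℕ ℓ < toℕ l₂ ⊎ toℕ l₄ < toℕ ℓ

  outer? : ∀ ℓ → Dec (Outer ℓ)
  outer? ℓ with toℕ ℓ <? toℕ l₂ | toℕ l₄ <? toℕ ℓ
  ... | yes p | _ = yes (inj₁ p)
  ... | no _ | yes q = yes (inj₂ q)
  ... | no p | no q = no λ { (inj₁ r) → p r ; (inj₂ r) → q r }

  ¬outer : ∀ {ℓ} → ¬ Outer ℓ → toℕ l₂ ≤ toℕ ℓ × toℕ ℓ ≤ toℕ l₄
  ¬outer ¬o = ≮⇒≥ (¬o ∘ inj₁) , ≮⇒≥ (¬o ∘ inj₂)

  leave-outer-next : ∀ {ℓ ℓ′} → CycNext ℓ ℓ′ → Outer ℓ → ¬ Outer ℓ′ → ℓ′ ≡ l₂ ⊎ ℓ′ ≡ l₄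
  leave-outer-next (inj₁ e) (inj₁ lt) ¬o = inj₁
    (Fin.toℕ-injective (≤-antisym (subst (_≤ toℕ l₂) e lt) (proj₁ (¬outer ¬o))))
  leave-outer-next (inj₁ e) (inj₂ gt) ¬o = contradiction (inj₂ (subst (toℕ l₄ <_) e (m<n⇒m<1+n gt))) ¬o
  leave-outer-next (inj₂ (_ , ℓ′≡0)) _ ¬o = contradiction
    (inj₁ (subst (_< toℕ l₂) (sym ℓ′≡0) (≤-trans (s≤s z≤n) l₁<l₂))) ¬o

  leave-outer-prev : ∀ {ℓ ℓ′} → CycNext ℓ′ ℓ → Outer ℓ → ¬ Outer ℓ′ → ℓ′ ≡ l₂ ⊎ ℓ′ ≡ l₄
  leave-outer-prev (inj₁ e) (inj₁ lt) ¬o = contradiction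
    (inj₁ (≤-trans (n≤1+n _) (subst (_< toℕ l₂) (sym e) lt))) ¬o
  leave-outer-prev (inj₁ e) (inj₂ gt) ¬o =
    inj₂ (Fin.toℕ-injective (≤-antisym (proj₂ (¬outer ¬o)) (s≤s⁻¹ (subst (toℕ l₄ <_) (sym e) gt))))
  leave-outer-prev (inj₂ (ℓ′+1≡D , _)) (inj₁ _) ¬o =
    inj₂ (Fin.toℕ-injective
      (≤-antisym (proj₂ (¬outer ¬o)) (subst (toℕ l₄ ≤_) (sym (suc-injective ℓ′+1≡D)) (s≤s⁻¹ (Fin.toℕ<n l₄)))))
  leave-outer-prev (inj₂ (_ , ℓ≡0)) (inj₂ gt) ¬o = contradiction (subst (toℕ l₄ <_) ℓ≡0 gt) λ ()

  penalty : Vertex (suc n) → ℕ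
  penalty (ℓ , y) with y ≟ᵇ x | outer? ℓ
  ... | yes _ | yes _ = 2
  ... | _ | _ = 0

  penalty≤2 : ∀ v → penalty v ≤ 2
  penalty≤2 (ℓ , y) with y ≟ᵇ x | outer? ℓ
  ... | yes _ | yes _ = ≤-refl
  ... | yes _ | no _ = z≤n
  ... | no _ | _ = z≤n

  penalty-≢ : ∀ ℓ {y} → y ≢ x → penalty (ℓ , y) ≡ 0
  penalty-≢ ℓ {y} y≢x with y ≟ᵇ x
  ... | yes y≡x = contradiction y≡x y≢x
  ... | no _ = refl

  penalty-outer : ∀ {ℓ} → Outer ℓ → penalty (ℓ , x) ≡ 2
  penalty-outer {ℓ} o with x ≟ᵇ x | outer? ℓ
  ... | yes _ | yes _ = refl
  ... | yes _ | no ¬o = contradiction o ¬o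
  ... | no x≢x | _ = contradiction refl x≢x

  penalty-inner : ∀ {ℓ} y → ¬ Outer ℓ → penalty (ℓ , y) ≡ 0
  penalty-inner {ℓ} y ¬o with y ≟ᵇ x | outer? ℓ
  ... | yes _ | yes o = contradiction o ¬o
  ... | yes _ | no _ = refl
  ... | no _ | _ = refl

  Allowed : Vertex (suc n) → Set
  Allowed v = v ≢ (l₂ , x) × v ≢ (l₄ , x)

  potential : Vertex (suc n) → ℕ
  potential v@(ℓ , y) = hamming y x + δ ℓ l₃ + penalty v

  penalty-cycle-x : ∀ {ℓ ℓ′} → CycNext ℓ ℓ′ ⊎ CycNext ℓ′ ℓ →
    Allowed (ℓ′ , x) ⊎ (ℓ′ , x) ≡ (l₃ , x) → penalty (ℓ , x) ≤ penalty (ℓ′ , x)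
  penalty-cycle-x {ℓ} {ℓ′} c ok = by-cases (outer? ℓ) (outer? ℓ′)
    where
    leave : Outer ℓ → ¬ Outer ℓ′ → CycNext ℓ ℓ′ ⊎ CycNext ℓ′ ℓ → ℓ′ ≡ l₂ ⊎ ℓ′ ≡ l₄
    leave o ¬o′ (inj₁ c) = leave-outer-next c o ¬o′
    leave o ¬o′ (inj₂ c) = leave-outer-prev c o ¬o′
    blocked : ℓ′ ≡ l₂ ⊎ ℓ′ ≡ l₄ → ¬ (Allowed (ℓ′ , x) ⊎ (ℓ′ , x) ≡ (l₃ , x))
    blocked (inj₁ refl) (inj₁ (≢l₂ , _)) = ≢l₂ refl
    blocked (inj₂ refl) (inj₁ (_ , ≢l₄)) = ≢l₄ refl
    blocked (inj₁ refl) (inj₂ e) = <-irrefl (cong (toℕ ∘ proj₁) e) l₂<l₃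
    blocked (inj₂ refl) (inj₂ e) = <-irrefl (cong (toℕ ∘ proj₁) (sym e)) l₃<l₄
    by-cases : Dec (Outer ℓ) → Dec (Outer ℓ′) → penalty (ℓ , x) ≤ penalty (ℓ′ , x)
    by-cases (no ¬o) _ = ≤-trans (≤-reflexive (penalty-inner x ¬o)) z≤n
    by-cases (yes o) (yes o′) = ≤-reflexive (trans (penalty-outer o) (sym (penalty-outer o′)))
    by-cases (yes o) (no ¬o′) = contradiction ok (blocked (leave o ¬o′ c))

  penalty-cycle : ∀ {ℓ ℓ′} y → CycNext ℓ ℓ′ ⊎ CycNext ℓ′ ℓ →
    Allowed (ℓ′ , y) ⊎ (ℓ′ , y) ≡ (l₃ , x) → penalty (ℓ , y) ≤ penalty (ℓ′ , y)
  penalty-cycle {ℓ} {ℓ′} y c ok = by-cases (y ≟ᵇ x) ok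
    where
    by-cases : Dec (y ≡ x) → Allowed (ℓ′ , y) ⊎ (ℓ′ , y) ≡ (l₃ , x) → penalty (ℓ , y) ≤ penalty (ℓ′ , y)
    by-cases (no y≢x) _ = ≤-trans (≤-reflexive (penalty-≢ ℓ y≢x)) z≤n
    by-cases (yes refl) ok = penalty-cycle-x c ok

  potential-step : ∀ {u w} → Adj (suc n) u w → Allowed u → Allowed w ⊎ w ≡ (l₃ , x) →
    potential u ≤ suc (potential w)
  potential-step {ℓ , y} {ℓ′ , .y} e@(inj₁ (refl , c)) _ ok =
    ≤-trans (+-mono-≤ (+-monoʳ-≤ (hamming y x) (δ-adj e l₃)) (penalty-cycle y c ok))
      (≤-reflexive (cong (_+ penalty (ℓ′ , y)) (+-suc (hamming y x) _)))
  potential-step {ℓ , y} (inj₂ (refl , refl)) _ _ with hamming-flip y x ℓ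
  ... | inj₁ h′≡h+1 =
    ≤-trans (+-monoʳ-≤ (hamming y x + δ ℓ l₃) (penalty≤2 (ℓ , y)))
      (subst (λ h′ → hamming y x + δ ℓ l₃ + 2 ≤ suc (h′ + δ ℓ l₃ + penalty (ℓ , flipBit y ℓ))) (sym h′≡h+1)
        (≤-trans (≤-reflexive (+-comm (hamming y x + δ ℓ l₃) 2)) (m≤m+n _ _)))
  ... | inj₂ h≡h′+1 =
    subst (λ h → h + δ ℓ l₃ + penalty (ℓ , y) ≤ suc (h′ + δ ℓ l₃ + penalty (ℓ , flipBit y ℓ))) (sym h≡h′+1)
      (subst (λ p → suc h′ + δ ℓ l₃ + p ≤ suc (h′ + δ ℓ l₃ + penalty (ℓ , flipBit y ℓ)))
        (sym (penalty-≢ ℓ y≢x))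
        (s≤s (≤-trans (≤-reflexive (+-identityʳ (h′ + δ ℓ l₃))) (m≤m+n _ _))))
    where
    h′ : ℕ
    h′ = hamming (flipBit y ℓ) x
    y≢x : y ≢ x
    y≢x refl = contradiction (trans (sym h≡h′+1) (hamming-self x)) λ ()

  potential-target : potential (l₃ , x) ≡ 0
  potential-target = trans (cong₂ (λ h d → h + d + penalty (l₃ , x)) (hamming-self x) (δ-refl l₃))
    (penalty-inner x λ { (inj₁ l₃<l₂) → <-asym l₃<l₂ l₂<l₃ ; (inj₂ l₄<l₃) → <-asym l₃<l₄ l₄<l₃ })

  not-visible : ∀ (Y : List (Vertex (suc n))) → (l₂ , x) ∈ Y → (l₄ , x) ∈ Y →
    ¬ Visible (suc n) Y (l₁ , x) (l₃ , x)
  not-visible Y l₂∈ l₄∈ (p , p-shortest , p-avoids) = <-irrefl refl (begin-strict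
    δ l₁ l₃                  <⟨ m<m+n (δ l₁ l₃) z<s ⟩
    δ l₁ l₃ + 2
      ≡⟨ cong₂ (λ h pen → h + δ l₁ l₃ + pen) (hamming-self x) (penalty-outer (inj₁ l₁<l₂)) ⟨
    potential (l₁ , x)
      ≤⟨ potential≤len potential Allowed (l₃ , x) potential-step potential-target p start-allowed
        internal-allowed ⟩
    len p                    ≤⟨ p-shortest (proj₁ (δ-walk l₁ l₃ x)) ⟩
    len (proj₁ (δ-walk l₁ l₃ x)) ≡⟨ proj₂ (δ-walk l₁ l₃ x) ⟩
    δ l₁ l₃                  ∎)
    where
    open ≤-Reasoning
    internal-allowed : All Allowed (internal p)
    internal-allowed = All.map (λ v∉Y → (λ { refl → v∉Y l₂∈ }) , (λ { refl → v∉Y l₄∈ })) p-avoids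
    start-allowed : Allowed (l₁ , x)
    start-allowed = (λ e → <-irrefl (cong (toℕ ∘ proj₁) e) l₁<l₂) ,
                    (λ e → <-irrefl (cong (toℕ ∘ proj₁) e) (<-trans l₁<l₂ (<-trans l₂<l₃ l₃<l₄)))

module _ {n : ℕ} where
  open Classes {Vertex (suc n)} _≟ᵇ_ proj₂ public using
    (class; ∈-class⁻; class-unique; length≡sum-length-class)

Increasing : ∀ {m} → List (Fin m) → Set
Increasing = Linked (λ a b → toℕ a < toℕ b)

cycleLevels : ∀ (Y : List (Vertex (suc n))) → Unique Y → ∀ x →
  Σ (List (Fin (suc n))) λ S → Increasing S × length S ≡ length (class x Y) × (∀ {l} → l ∈ S → (l , x) ∈ Y)
cycleLevels {n} Y Y-unique x = sort levels , increasing (sort levels) sort-unique (sort-↗ levels) ,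
  length-sort , ∈-sort⁻
  where
  open import Data.List.Sort (Fin.≤-decTotalOrder (suc n)) using (sort; sort-↭; sort-↗)
  members : List (Vertex (suc n))
  members = class x Y
  levels : List (Fin (suc n))
  levels = map proj₁ members
  members-on-x : All (λ v → proj₂ v ≡ x) members
  members-on-x = All.tabulate (λ v∈ → proj₂ (∈-class⁻ Y v∈))
  levels-unique : ∀ vs → Unique vs → All (λ v → proj₂ v ≡ x) vs → Unique (map proj₁ vs)
  levels-unique [] _ _ = []
  levels-unique (v ∷ vs) (v∉ ∷ u) (v-on-x ∷ on-x) = distinct vs v∉ on-x ∷ levels-unique vs u on-x
    where
    distinct : ∀ ws → All (v ≢_) ws → All (λ w → proj₂ w ≡ x) ws → All (proj₁ v ≢_) (map proj₁ ws)
    distinct [] _ _ = []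
    distinct (w ∷ ws) (v≢w ∷ v∉) (w-on-x ∷ on-x) = (λ e → v≢w (cong₂ _,_ e (trans v-on-x (sym w-on-x)))) ∷
      distinct ws v∉ on-x
  sort-unique : Unique (sort levels)
  sort-unique = ↭ₛ.Unique-resp-↭ (setoid _) (↭.↭⇒↭ₛ (↭.↭-sym (sort-↭ levels)))
                  (levels-unique members (class-unique x Y Y-unique) members-on-x)
  length-sort : length (sort levels) ≡ length members
  length-sort = trans (↭.↭-length (sort-↭ levels)) (length-map proj₁ members)
  ∈-sort⁻ : ∀ {l} → l ∈ sort levels → (l , x) ∈ Y
  ∈-sort⁻ l∈ with ∈.∈-map⁻ proj₁ (↭.∈-resp-↭ (sort-↭ levels) l∈)
  ... | v , v∈ , refl with ∈-class⁻ Y v∈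
  ... | v∈Y , refl = v∈Y
  increasing : ∀ S → Unique S → Linked (λ a b → toℕ a ≤ toℕ b) S → Increasing S
  increasing [] _ _ = []
  increasing (a ∷ []) _ _ = [-]
  increasing (a ∷ b ∷ S) ((a≢b ∷ _) ∷ u) (a≤b ∷ sorted) =
    ≤∧≢⇒< a≤b (a≢b ∘ Fin.toℕ-injective) ∷ increasing (b ∷ S) u sorted

cycle-meets-≤3 : ∀ (Y : List (Vertex (suc n))) → IsMutualVisibilitySet (suc n) Y →
  ∀ x → length (class x Y) ≤ 3
cycle-meets-≤3 Y (Y-unique , Y-visible) x with cycleLevels Y Y-unique x
... | S , S-increasing , length-S , S⊆Y = subst (_≤ 3) length-S (at-most-three S S-increasing S⊆Y)
  where
  at-most-three : ∀ S → Increasing S → (∀ {l} → l ∈ S → (l , x) ∈ Y) → length S ≤ 3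
  at-most-three [] _ _ = z≤n
  at-most-three (_ ∷ []) _ _ = s≤s z≤n
  at-most-three (_ ∷ _ ∷ []) _ _ = s≤s (s≤s z≤n)
  at-most-three (_ ∷ _ ∷ _ ∷ []) _ _ = ≤-refl
  at-most-three (l₁ ∷ l₂ ∷ l₃ ∷ l₄ ∷ _) (l₁<l₂ ∷ l₂<l₃ ∷ l₃<l₄ ∷ _) S⊆Y =
    contradiction (Y-visible (S⊆Y (here refl)) (S⊆Y (there (there (here refl)))))
      (FourLevels.not-visible x l₁ l₂ l₃ l₄ l₁<l₂ l₂<l₃ l₃<l₄ Y (S⊆Y (there (here refl)))
        (S⊆Y (there (there (there (here refl))))))

length≡sum-cycles : ∀ (Y : List (Vertex (suc n))) →
  length Y ≡ sum (map (λ x → length (class x Y)) (allBitStrings (suc n)))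
length≡sum-cycles {n} = length≡sum-length-class (allBitStrings (suc n)) (allBitStrings-unique (suc n))
  ∈-allBitStrings

μ≤3*2^d : ∀ (Y : List (Vertex (suc n))) → IsMutualVisibilitySet (suc n) Y → length Y ≤ 3 * 2 ^ suc n
μ≤3*2^d {n} Y Y-mv = begin
  length Y                                                       ≡⟨ length≡sum-cycles Y ⟩
  sum (map (λ x → length (class x Y)) (allBitStrings (suc n)))
    ≤⟨ sum-map-≤ _ 3 (allBitStrings (suc n)) (cycle-meets-≤3 Y Y-mv) ⟩
  3 * length (allBitStrings (suc n))
    ≡⟨ cong (3 *_) (length-allBitStrings (suc n)) ⟩
  3 * 2 ^ suc n                                                  ∎
  where open ≤-Reasoning

-- Lower bound for d ≥ 4

data LastDifference {m} (v v′ : Vec Bool m) : Set where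
  identical : v ≡ v′ → LastDifference v v′
  at : ∀ t → lookup v t ≢ lookup v′ t → (∀ i → toℕ t < toℕ i → lookup v i ≡ lookup v′ i) → LastDifference v v′

lastDifference : ∀ {m} (v v′ : Vec Bool m) → LastDifference v v′
lastDifference [] [] = identical refl
lastDifference (a ∷ v) (a′ ∷ v′) with lastDifference v v′
... | at t ne agree = at (suc t) ne λ { (suc i) (s≤s t<i) → agree i t<i }
... | identical refl with a Bool.≟ a′
...   | yes refl = identical refl
...   | no a≢a′ = at zero a≢a′ λ { (suc i) _ → refl }

zerosThen : ∀ r → Bool → Vec Bool (suc r)
zerosThen zero b = b ∷ []
zerosThen (suc r) b = false ∷ zerosThen r b

lookup-zerosThen-last : ∀ r b → lookup (zerosThen r b) (fromℕ r) ≡ b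
lookup-zerosThen-last zero b = refl
lookup-zerosThen-last (suc r) b = lookup-zerosThen-last r b

lookup-zerosThen-< : ∀ r b (j : Fin (suc r)) → toℕ j < r → lookup (zerosThen r b) j ≡ false
lookup-zerosThen-< (suc r) b zero _ = refl
lookup-zerosThen-< (suc r) b (suc j) (s≤s j<r) = lookup-zerosThen-< r b j j<r

-- The mutual-visibility set for d = c + k + 2: all vertices [0, b v 0ᵏ b] with
-- b ∈ {0,1} and v ∈ {0,1}ᶜ.
module Construction (c k : ℕ) (c≤k+3 : c ≤ k + 3) where

  N : ℕ
  N = c + suc k

  codeword : Vec Bool (suc c) → Vec Bool (suc N)
  codeword (b ∷ v) = b ∷ (v ++ᵛ zerosThen k b)

  freeLevel : Fin c → Fin (suc N)
  freeLevel i = suc (i ↑ˡ suc k)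

  padLevel : Fin (suc k) → Fin (suc N)
  padLevel j = suc (c ↑ʳ j)

  lastLevel : Fin (suc N)
  lastLevel = padLevel (fromℕ k)

  toℕ-freeLevel : ∀ i → toℕ (freeLevel i) ≡ suc (toℕ i)
  toℕ-freeLevel i = cong suc (Fin.toℕ-↑ˡ i (suc k))

  toℕ-lastLevel : toℕ lastLevel ≡ N
  toℕ-lastLevel = trans (cong suc (trans (Fin.toℕ-↑ʳ c (fromℕ k)) (cong (c +_) (Fin.toℕ-fromℕ k))))
    (sym (+-suc c k))

  lookup-free : ∀ b v i → lookup (codeword (b ∷ v)) (freeLevel i) ≡ lookup v i
  lookup-free b v i = lookup-++ˡ v (zerosThen k b) i

  lookup-pad : ∀ b v j → toℕ j < k → lookup (codeword (b ∷ v)) (padLevel j) ≡ false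
  lookup-pad b v j j<k = trans (lookup-++ʳ v (zerosThen k b) j) (lookup-zerosThen-< k b j j<k)

  lookup-last : ∀ b v → lookup (codeword (b ∷ v)) lastLevel ≡ b
  lookup-last b v = trans (lookup-++ʳ v (zerosThen k b) (fromℕ k)) (lookup-zerosThen-last k b)

  data Position : Fin (suc N) → Set where
    first : Position zero
    free : ∀ i → Position (freeLevel i)
    pad : ∀ j → toℕ j < k → Position (padLevel j)
    last : Position lastLevel

  position : ∀ p → Position p
  position zero = first
  position (suc q) = subst (Position ∘ suc) (Fin.join-splitAt c (suc k) q) (by-part (splitAt c q))
    where
    by-part : ∀ s → Position (suc (join c (suc k) s))
    by-part (inj₁ i) = free i
    by-part (inj₂ j) with toℕ j ≟ k
    ... | yes j≡k = subst (Position ∘ padLevel) (Fin.toℕ-injective (trans (Fin.toℕ-fromℕ k) (sym j≡k))) last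
    ... | no j≢k = pad j (≤∧≢⇒< (s≤s⁻¹ (Fin.toℕ<n j)) j≢k)

  codeword-injective : ∀ {w w′} → codeword w ≡ codeword w′ → w ≡ w′
  codeword-injective {b ∷ v} {b′ ∷ v′} e = cong₂ _∷_ (cong (λ y → lookup y zero) e)
    (lookup-extensionality v v′ λ i → trans (sym (lookup-free b v i))
      (trans (cong (λ y → lookup y (freeLevel i)) e) (lookup-free b′ v′ i)))

  X : List (Vertex (suc N))
  X = map (λ w → (zero , codeword w)) (allBitStrings (suc c))

  length-X : length X ≡ 2 ^ suc c
  length-X = trans (length-map _ (allBitStrings (suc c))) (length-allBitStrings (suc c))

  X-unique : Unique X
  X-unique = Unique.map⁺ (codeword-injective ∘ cong proj₂) (allBitStrings-unique (suc c))

  ∈-X⁻ : ∀ {z} → z ∈ X → Σ (Vec Bool (suc c)) λ w → z ≡ (zero , codeword w)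
  ∈-X⁻ z∈ with ∈.∈-map⁻ _ z∈
  ... | w , _ , e = w , e

  Good : Vertex (suc N) → Set
  Good (ℓ , y) = ℓ ≢ zero ⊎ lookup y zero ≢ lookup y lastLevel

  good∉X : ∀ {z} → Good z → z ∉ X
  good∉X g z∈ with ∈-X⁻ z∈
  good∉X (inj₁ ℓ≢0) _ | _ , refl = ℓ≢0 refl
  good∉X (inj₂ ne) _ | b ∷ v , refl = ne (sym (lookup-last b v))

  module Pair (b : Bool) (v : Vec Bool c) (b′ : Bool) (v′ : Vec Bool c) where
    open import Data.List.Membership.DecPropositional (Fin._≟_ {suc N}) using (_∈?_)

    x x′ : Vec Bool (suc N)
    x = codeword (b ∷ v)
    x′ = codeword (b′ ∷ v′)

    open Routes x′

    Covers : List Move → Set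
    Covers ms = ∀ p → p ∈ visited zero ms ⊎ lookup x p ≡ lookup x′ p

    endBits-covers : ∀ ms → Covers ms → endBits zero x ms ≡ x′
    endBits-covers ms covers = lookup-extensionality _ _ λ p → by-cases p (p ∈? visited zero ms)
      where
      by-cases : ∀ p → Dec (p ∈ visited zero ms) → lookup (endBits zero x ms) p ≡ lookup x′ p
      by-cases p (yes p∈) = lookup-endBits-visited zero x ms p p∈
      by-cases p (no p∉) with covers p
      ... | inj₁ p∈ = contradiction p∈ p∉
      ... | inj₂ agree = trans (lookup-endBits-unvisited zero x ms p p∉) agree

    flipped-good : lookup x zero ≢ lookup x′ zero → Good (zero , flipBit x zero)
    flipped-good _ = inj₂ λ e → not-¬ refl
      (sym (trans e (trans (lookup-flipBit-other x {zero} {lastLevel} λ ()) (lookup-last b v))))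

    ≤-tour : ∀ i j → lookup x i ≢ lookup x′ i → lookup x j ≢ lookup x′ j →
      ∀ {α β γ} → α ≤ δ zero i → β ≤ δ i j → γ ≤ δ zero j →
      α + β + γ ≤ DistanceBound.tour zero x′ i j zero (DistanceBound.differs zero x′ i j x i)
        (DistanceBound.differs zero x′ i j x j)
    ≤-tour i j i-differs j-differs {α} {β} {γ} α≤ β≤ γ≤ =
      subst₂ (λ p q → α + β + γ ≤ tour zero p q) (sym (differs-≢ x {i} i-differs))
        (sym (differs-≢ x {j} j-differs))
        (≤-tour-round α≤ β≤ γ≤)
      where open DistanceBound zero x′ i j

    good-after : ∀ m ms y → zero ∉ visited (step m zero) ms →
      ∀ {u} → u ∈ initVerts (route (step m zero) (fix zero y) ms) → Good u
    good-after m ms y leaves u∈ = inj₁ λ e → leaves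
      (subst (_∈ _) e (level-initVerts-route (step m zero) (fix zero y) ms u∈))

    visible-by-route : ∀ m ms i j → endLevel zero (m ∷ ms) ≡ zero → Covers (m ∷ ms) →
      zero ∉ visited (step m zero) ms → lookup x i ≢ lookup x′ i → lookup x j ≢ lookup x′ j →
      ∀ {α β γ} → α ≤ δ zero i → β ≤ δ i j → γ ≤ δ zero j → length (m ∷ ms) ≤ α + β + γ →
      Visible (suc N) X (zero , x) (zero , x′)
    visible-by-route m ms i j returns covers leaves i-differs j-differs α≤ β≤ γ≤ ms≤ =
      visible-if-≤bound X (cong₂ _,_ returns reaches) (route zero x (m ∷ ms))
        (All.map good∉X (All-internal-route Good zero x m ms flipped-good (good-after m ms x leaves)))
        (≤-trans (≤-reflexive (trans (len-route-to-target zero x (m ∷ ms) reaches) (+-comm _ (hamming x x′))))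
          (+-monoʳ-≤ (hamming x x′) (≤-trans ms≤ (≤-tour i j i-differs j-differs α≤ β≤ γ≤))))
      where
      open DistanceBound zero x′ i j
      reaches : endBits zero x (m ∷ ms) ≡ x′
      reaches = endBits-covers (m ∷ ms) covers

    covers-off-last : ∀ ms → zero ∈ visited zero ms →
      (∀ i → lookup v i ≢ lookup v′ i → freeLevel i ∈ visited zero ms) →
      ∀ p → p ≢ lastLevel → p ∈ visited zero ms ⊎ lookup x p ≡ lookup x′ p
    covers-off-last ms zero∈ free∈ p p≢last with position p
    ... | first = inj₁ zero∈
    ... | pad j j<k = inj₂ (trans (lookup-pad b v j j<k) (sym (lookup-pad b′ v′ j j<k)))
    ... | last = contradiction refl p≢last
    ... | free i with lookup v i Bool.≟ lookup v′ i
    ...   | yes e = inj₂ (trans (lookup-free b v i) (trans e (sym (lookup-free b′ v′ i))))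
    ...   | no ne = inj₁ (free∈ i ne)

    covers-by : ∀ ms → zero ∈ visited zero ms →
      (∀ i → lookup v i ≢ lookup v′ i → freeLevel i ∈ visited zero ms) →
      (b ≢ b′ → lastLevel ∈ visited zero ms) → Covers ms
    covers-by ms zero∈ free∈ last∈ p with p Fin.≟ lastLevel | b Bool.≟ b′
    ... | no p≢last | _ = covers-off-last ms zero∈ free∈ p p≢last
    ... | yes refl | yes e = inj₂ (trans (lookup-last b v) (trans e (sym (lookup-last b′ v′))))
    ... | yes refl | no ne = inj₁ (last∈ ne)

    1≤N : 1 ≤ N
    1≤N = ≤-trans (s≤s z≤n) (m≤n+m (suc k) c)

    1≤δ-last : 1 ≤ δ zero lastLevel
    1≤δ-last = ≤-δ zero lastLevel (subst (1 ≤_) (sym toℕ-lastLevel) 1≤N)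
                 (subst (λ z → 1 ≤ suc N ∸ z) (sym toℕ-lastLevel) (≤-reflexive (sym (m+n∸n≡m 1 N))))

    last-differs : b ≢ b′ → lookup x lastLevel ≢ lookup x′ lastLevel
    last-differs b≢b′ e = b≢b′ (trans (sym (lookup-last b v)) (trans e (lookup-last b′ v′)))

    free-differs : ∀ {i} → lookup v i ≢ lookup v′ i → lookup x (freeLevel i) ≢ lookup x′ (freeLevel i)
    free-differs {i} ne e = ne (trans (sym (lookup-free b v i)) (trans e (lookup-free b′ v′ i)))

    last∈excursion⁻ : ∀ {e} → e ≤ N → lastLevel ∈ visited zero (excursion⁻ (suc e))
    last∈excursion⁻ {e} e≤N = ∈-visited-excursion⁻ e≤N lastLevel
      (≤-trans (≤-reflexive (sym toℕ-lastLevel)) (m≤m+n _ e))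

    visible-only-b : b ≢ b′ → v ≡ v′ → Visible (suc N) X (zero , x) (zero , x′)
    visible-only-b b≢b′ refl =
      visible-by-route bwd (fwd ∷ []) lastLevel lastLevel (endLevel-excursion⁻ 1 zero)
        (covers-by (excursion⁻ 1) (here refl) (λ _ ne → contradiction refl ne) (λ _ → last∈excursion⁻ z≤n))
        (zero∉visited-excursion⁻ z≤n 1≤N) (last-differs b≢b′) (last-differs b≢b′) 1≤δ-last z≤n 1≤δ-last ≤-refl

    module LastDifferenceAt (t : Fin c) (t-differs : lookup v t ≢ lookup v′ t)
      (agree-above : ∀ i → toℕ t < toℕ i → lookup v i ≡ lookup v′ i) where

      m : ℕ
      m = suc (toℕ t)

      M : Fin (suc N)
      M = freeLevel t

      toℕ-M : toℕ M ≡ m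
      toℕ-M = toℕ-freeLevel t

      m≤c : m ≤ c
      m≤c = Fin.toℕ<n t

      m≤N : m ≤ N
      m≤N = ≤-trans m≤c (m≤m+n c (suc k))

      M-differs : lookup x M ≢ lookup x′ M
      M-differs = free-differs t-differs

      differs≤t : ∀ i → lookup v i ≢ lookup v′ i → toℕ i ≤ toℕ t
      differs≤t i ne = ≮⇒≥ (ne ∘ agree-above i)

      -- this is where c ≤ k + 3 is needed
      t+t≤D : toℕ t + toℕ t ≤ suc N
      t+t≤D = ≤-trans (s≤s⁻¹ (s≤s⁻¹ m+m≤N+2)) (n≤1+n N)
        where
        m+m≤N+2 : suc (suc (toℕ t + toℕ t)) ≤ suc (suc N)
        m+m≤N+2 = subst₂ _≤_ (cong suc (+-suc (toℕ t) (toℕ t))) (trans (+-suc c _) (cong suc (+-suc c _)))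
                    (+-mono-≤ m≤c (≤-trans m≤c (≤-trans c≤k+3 (≤-reflexive (+-comm k 3)))))

      m≤δ-M : m + m ≤ suc N → m ≤ δ zero M
      m≤δ-M 2m≤D = ≤-δ zero M (≤-reflexive (sym toℕ-M))
        (subst (λ z → m ≤ suc N ∸ z) (sym toℕ-M) (m+n≤o⇒m≤o∸n m 2m≤D))

      D∸m≤δ-M : ¬ (m + m ≤ suc N) → suc N ∸ m ≤ δ zero M
      D∸m≤δ-M long = ≤-δ zero M (subst (suc N ∸ m ≤_) (sym toℕ-M) D∸m≤m)
        (subst (λ z → suc N ∸ m ≤ suc N ∸ z) (sym toℕ-M) ≤-refl)
        where
        D∸m≤m : suc N ∸ m ≤ m
        D∸m≤m = ≤-trans (∸-monoˡ-≤ m (<⇒≤ (≰⇒> long))) (≤-reflexive (m+n∸m≡n m m))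

      visible-same-b : b ≡ b′ → m + m ≤ suc N → Visible (suc N) X (zero , x) (zero , x′)
      visible-same-b b≡b′ 2m≤D =
        visible-by-route fwd (fwds (toℕ t) ++ bwds m) M M (endLevel-excursion⁺ m zero)
          (covers-by (excursion⁺ m) (here refl) free∈ (contradiction b≡b′))
          (zero∉visited-excursion⁺ m≤N) M-differs M-differs (m≤δ-M 2m≤D) z≤n (m≤δ-M 2m≤D)
          (≤-reflexive (trans (length-excursion⁺ m) (cong (_+ m) (sym (+-identityʳ m)))))
        where
        free∈ : ∀ i → lookup v i ≢ lookup v′ i → freeLevel i ∈ visited zero (excursion⁺ m)
        free∈ i ne = ∈-visited-excursion⁺ m≤N (freeLevel i)
          (subst (_≤ m) (sym (toℕ-freeLevel i)) (s≤s (differs≤t i ne)))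

      visible-around : ¬ (m + m ≤ suc N) → ∀ j → toℕ j < toℕ t → lookup v j ≢ lookup v′ j →
        Visible (suc N) X (zero , x) (zero , x′)
      visible-around long j j<t j-differs =
        visible-by-route fwd (fwds N) Lj M (endLevel-loop zero) (λ p → inj₁ (∈-visited-loop p))
          (zero∉visited-loop 1≤N) (free-differs j-differs) M-differs α≤ β≤ (D∸m≤δ-M long) (≤-reflexive len≡)
        where
        Lj : Fin (suc N)
        Lj = freeLevel j
        a : ℕ
        a = suc (toℕ j)
        a≤m : a ≤ m
        a≤m = ≤-trans j<t (n≤1+n _)
        α≤ : a ≤ δ zero Lj
        α≤ = ≤-δ zero Lj (≤-reflexive (sym (toℕ-freeLevel j)))
               (subst (λ z → a ≤ suc N ∸ z) (sym (toℕ-freeLevel j))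
                 (m+n≤o⇒m≤o∸n a (≤-trans (+-mono-≤ j<t j<t) t+t≤D)))
        ∣J-M∣ : ∣ toℕ Lj - toℕ M ∣ ≡ m ∸ a
        ∣J-M∣ = trans (cong₂ ∣_-_∣ (toℕ-freeLevel j) toℕ-M) (trans (∣-∣-comm a m) (m≤n⇒∣n-m∣≡n∸m a≤m))
        m∸a≤t : m ∸ a ≤ toℕ t
        m∸a≤t = m∸n≤m (toℕ t) (toℕ j)
        β≤ : m ∸ a ≤ δ Lj M
        β≤ = ≤-δ Lj M (≤-reflexive (sym ∣J-M∣))
               (subst (λ z → m ∸ a ≤ suc N ∸ z) (sym ∣J-M∣)
                 (m+n≤o⇒m≤o∸n (m ∸ a) (≤-trans (+-mono-≤ m∸a≤t m∸a≤t) t+t≤D)))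
        len≡ : length (fwds (suc N)) ≡ a + (m ∸ a) + (suc N ∸ m)
        len≡ = trans (length-replicate (suc N)) $ sym $
          (trans (cong (_+ (suc N ∸ m)) (m+[n∸m]≡n a≤m)) (m+[n∸m]≡n (≤-trans m≤N (n≤1+n N))))

      visible-back : ¬ (m + m ≤ suc N) → (∀ i → lookup v i ≢ lookup v′ i → toℕ t ≤ toℕ i) →
        Visible (suc N) X (zero , x) (zero , x′)
      visible-back long only-t =
        visible-by-route bwd (bwds e ++ fwds (suc e)) M M (endLevel-excursion⁻ (suc e) zero)
          (covers-by (excursion⁻ (suc e)) (here refl) free∈ (λ _ → last∈excursion⁻ e≤N))
          (zero∉visited-excursion⁻ e≤N e<N) M-differs M-differs (D∸m≤δ-M long) z≤n (D∸m≤δ-M long)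
          (≤-reflexive len≡)
        where
        e : ℕ
        e = N ∸ m
        e≤N : e ≤ N
        e≤N = m∸n≤m N m
        e<N : e < N
        e<N = ∸-monoʳ-< z<s m≤N
        D∸m≡1+e : suc N ∸ m ≡ suc e
        D∸m≡1+e = +-∸-assoc 1 m≤N
        free∈ : ∀ i → lookup v i ≢ lookup v′ i → freeLevel i ∈ visited zero (excursion⁻ (suc e))
        free∈ i ne = ∈-visited-excursion⁻ e≤N (freeLevel i)
          (≤-reflexive (sym (trans (cong (_+ e) (trans (toℕ-freeLevel i) (cong suc i≡t))) (m+[n∸m]≡n m≤N))))
          where
          i≡t : toℕ i ≡ toℕ t
          i≡t = ≤-antisym (differs≤t i ne) (only-t i ne)
        len≡ : length (excursion⁻ (suc e)) ≡ suc N ∸ m + 0 + (suc N ∸ m)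
        len≡ = trans (length-excursion⁻ (suc e)) $ trans
          (cong₂ _+_ (sym (trans (+-identityʳ _) D∸m≡1+e)) (sym D∸m≡1+e)) refl

      visible-around-last : b ≢ b′ → m + m ≤ suc N → ¬ (m + m + 2 ≤ suc N) → Visible (suc N) X (zero , x)
        (zero , x′)
      visible-around-last b≢b′ 2m≤D long =
        visible-by-route fwd (fwds N) M lastLevel (endLevel-loop zero) (λ p → inj₁ (∈-visited-loop p))
          (zero∉visited-loop 1≤N) M-differs (last-differs b≢b′) (m≤δ-M 2m≤D) β≤ 1≤δ-last (≤-reflexive len≡)
        where
        ∣M-last∣ : ∣ toℕ M - toℕ lastLevel ∣ ≡ N ∸ m
        ∣M-last∣ = trans (cong₂ ∣_-_∣ toℕ-M toℕ-lastLevel) (trans (∣-∣-comm m N) (m≤n⇒∣n-m∣≡n∸m m≤N))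
        N≤m+m : N ≤ m + m
        N≤m+m = s≤s⁻¹ (s≤s⁻¹ (≤-trans (≰⇒> long) (≤-reflexive (+-comm (m + m) 2))))
        β≤ : N ∸ m ≤ δ M lastLevel
        β≤ = ≤-δ M lastLevel (≤-reflexive (sym ∣M-last∣))
               (subst (λ z → N ∸ m ≤ suc N ∸ z) (sym ∣M-last∣)
                 (subst (N ∸ m ≤_) (sym (trans (+-∸-assoc 1 (m∸n≤m N m)) (cong suc (m∸[m∸n]≡n m≤N))))
                   (≤-trans (∸-monoˡ-≤ m N≤m+m) (≤-trans (≤-reflexive (m+n∸m≡n m m)) (n≤1+n m)))))
        len≡ : length (fwds (suc N)) ≡ m + (N ∸ m) + 1
        len≡ = trans (length-replicate (suc N)) $ trans (+-comm 1 N) (cong (_+ 1) (sym (m+[n∸m]≡n m≤N)))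

      -- First fix the free bits on an excursion up to level m, then the last bit on an
      -- excursion down to level N. In between, level 0 is passed with the first bit
      -- fixed but the last one not yet, so that vertex is not in X.
      module OutAndBack (b≢b′ : b ≢ b′) (2m+2≤D : m + m + 2 ≤ suc N) where

        out : List Move
        out = excursion⁺ m

        y₁ : Vec Bool (suc N)
        y₁ = endBits zero x out

        r₁ : Walk (suc N) (zero , x) (endLevel zero out , y₁)
        r₁ = route zero x out

        r₂ : Walk (suc N) (endLevel zero out , y₁)
          (endLevel (endLevel zero out) (excursion⁻ 1) , endBits (endLevel zero out) y₁ (excursion⁻ 1))
        r₂ = route (endLevel zero out) y₁ (excursion⁻ 1)

        2m≤D : m + m ≤ suc N
        2m≤D = ≤-trans (m≤m+n (m + m) 2) 2m+2≤D

        free∈ : ∀ i → lookup v i ≢ lookup v′ i → freeLevel i ∈ visited zero out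
        free∈ i ne = ∈-visited-excursion⁺ m≤N (freeLevel i)
          (subst (_≤ m) (sym (toℕ-freeLevel i)) (s≤s (differs≤t i ne)))

        y₁-zero : lookup y₁ zero ≡ lookup x′ zero
        y₁-zero = lookup-endBits-visited zero x out zero (here refl)

        y₁-last : lookup y₁ lastLevel ≡ b
        y₁-last = trans (lookup-endBits-unvisited zero x out lastLevel last∉) (lookup-last b v)
          where
          last∉ : lastLevel ∉ visited zero out
          last∉ last∈ = <⇒≱ (≤-trans (s≤s m≤c) (m<m+n c z<s))
                          (subst (_≤ m) toℕ-lastLevel (∈-visited-excursion⁺⁻ m≤N last∈))

        y₁-off-last : ∀ p → p ≢ lastLevel → lookup y₁ p ≡ lookup x′ p
        y₁-off-last p p≢last with p ∈? visited zero out
        ... | yes p∈ = lookup-endBits-visited zero x out p p∈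
        ... | no p∉ with covers-off-last out (here refl) free∈ p p≢last
        ...   | inj₁ p∈ = contradiction p∈ p∉
        ...   | inj₂ agree = trans (lookup-endBits-unvisited zero x out p p∉) agree

        y₁-good : Good (zero , y₁)
        y₁-good = inj₂ λ e → b≢b′ (sym (trans (sym y₁-zero) (trans e y₁-last)))

        second-leg : ∀ {ℓ} → ℓ ≡ zero →
          (endLevel ℓ (excursion⁻ 1) , endBits ℓ y₁ (excursion⁻ 1)) ≡ (zero , x′) ×
          All Good (initVerts (route ℓ y₁ (excursion⁻ 1)))
        second-leg refl = cong₂ _,_ (endLevel-excursion⁻ 1 zero) (lookup-extensionality _ _ fixed) ,
          All-initVerts (route zero y₁ (excursion⁻ 1)) y₁-good
            (All-internal-route Good zero y₁ bwd (fwd ∷ []) (contradiction y₁-zero)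
              (good-after bwd (fwd ∷ []) y₁ (zero∉visited-excursion⁻ z≤n 1≤N)))
          where
          fixed : ∀ p → lookup (endBits zero y₁ (excursion⁻ 1)) p ≡ lookup x′ p
          fixed p with p ∈? visited zero (excursion⁻ 1)
          ... | yes p∈ = lookup-endBits-visited zero y₁ (excursion⁻ 1) p p∈
          ... | no p∉ = trans (lookup-endBits-unvisited zero y₁ (excursion⁻ 1) p p∉)
                          (y₁-off-last p λ { refl → p∉ (last∈excursion⁻ z≤n) })

        reaches : (endLevel (endLevel zero out) (excursion⁻ 1) , endBits (endLevel zero out) y₁
          (excursion⁻ 1)) ≡ (zero , x′)
        reaches = proj₁ (second-leg (endLevel-excursion⁺ m zero))

        avoids : All (_∉ X) (internal (r₁ ++ʷ r₂))
        avoids = All.map good∉X (All-internal-++ʷ r₁ r₂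
          (All-internal-route Good zero x fwd (fwds (toℕ t) ++ bwds m) flipped-good
            (good-after fwd (fwds (toℕ t) ++ bwds m) x (zero∉visited-excursion⁺ m≤N)))
          (proj₂ (second-leg (endLevel-excursion⁺ m zero))))

        len≡ : len (r₁ ++ʷ r₂) ≡ hamming x x′ + (m + suc m + 1)
        len≡ = begin
          len (r₁ ++ʷ r₂)                  ≡⟨ len-++ʷ r₁ r₂ ⟩
          len r₁ + len r₂
            ≡⟨ cong (len r₁ +_) (len-route-to-target _ y₁ (excursion⁻ 1) (cong proj₂ reaches)) ⟩
          len r₁ + (2 + hamming y₁ x′)     ≡⟨ x∙yz≈y∙xz (len r₁) 2 (hamming y₁ x′) ⟩
          2 + (len r₁ + hamming y₁ x′)     ≡⟨ cong (2 +_) (len-route zero x out) ⟩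
          2 + (length out + hamming x x′)  ≡⟨ cong (λ l → 2 + (l + hamming x x′)) (length-excursion⁺ m) ⟩
          2 + (m + m + hamming x x′)       ≡⟨ rearrange m (hamming x x′) ⟩
          hamming x x′ + (m + suc m + 1)   ∎
          where
          open ≡-Reasoning
          rearrange : ∀ m h → 2 + (m + m + h) ≡ h + (m + suc m + 1)
          rearrange = solve-∀

        1+m≤δ-M-last : suc m ≤ δ M lastLevel
        1+m≤δ-M-last = ≤-δ M lastLevel (subst (suc m ≤_) (sym ∣M-last∣) 1+m≤N∸m)
          (subst (λ z → suc m ≤ suc N ∸ z) (sym ∣M-last∣)
            (≤-reflexive (sym (trans (+-∸-assoc 1 (m∸n≤m N m)) (cong suc (m∸[m∸n]≡n m≤N))))))
          where
          ∣M-last∣ : ∣ toℕ M - toℕ lastLevel ∣ ≡ N ∸ m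
          ∣M-last∣ = trans (cong₂ ∣_-_∣ toℕ-M toℕ-lastLevel) (trans (∣-∣-comm m N) (m≤n⇒∣n-m∣≡n∸m m≤N))
          1+m≤N∸m : suc m ≤ N ∸ m
          1+m≤N∸m = m+n≤o⇒m≤o∸n (suc m) (s≤s⁻¹ (≤-trans (≤-reflexive (+-comm 2 (m + m))) 2m+2≤D))

        visible-out-and-back : Visible (suc N) X (zero , x) (zero , x′)
        visible-out-and-back = visible-if-≤bound X reaches (r₁ ++ʷ r₂) avoids
          (≤-trans (≤-reflexive len≡) (+-monoʳ-≤ (hamming x x′)
            (≤-tour M lastLevel M-differs (last-differs b≢b′) (m≤δ-M 2m≤D) 1+m≤δ-M-last 1≤δ-last)))
          where open DistanceBound zero x′ M lastLevel

    visible-pair : Visible (suc N) X (zero , x) (zero , x′)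
    visible-pair with b Bool.≟ b′ | lastDifference v v′
    ... | yes refl | identical refl = visible-self
    ... | no b≢b′ | identical v≡v′ = visible-only-b b≢b′ v≡v′
    ... | b≟b′ | at t t-differs agree-above = by-length b≟b′ (m + m ≤? suc N)
      where
      open LastDifferenceAt t t-differs agree-above
      long : ¬ (m + m ≤ suc N) → Visible (suc N) X (zero , x) (zero , x′)
      long ¬2m≤D with Fin.any? (λ j → (toℕ j <? toℕ t) ×-dec ¬? (lookup v j Bool.≟ lookup v′ j))
      ... | yes (j , j<t , j-differs) = visible-around ¬2m≤D j j<t j-differs
      ... | no none-below = visible-back ¬2m≤D (λ i ne → ≮⇒≥ (λ i<t → none-below (i , i<t , ne)))
      by-length : Dec (b ≡ b′) → Dec (m + m ≤ suc N) → Visible (suc N) X (zero , x) (zero , x′)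
      by-length _ (no ¬2m≤D) = long ¬2m≤D
      by-length (yes b≡b′) (yes 2m≤D) = visible-same-b b≡b′ 2m≤D
      by-length (no b≢b′) (yes 2m≤D) with m + m + 2 ≤? suc N
      ... | yes 2m+2≤D = OutAndBack.visible-out-and-back b≢b′ 2m+2≤D
      ... | no ¬2m+2≤D = visible-around-last b≢b′ 2m≤D ¬2m+2≤D

  X-mutual-visibility : IsMutualVisibilitySet (suc N) X
  X-mutual-visibility = X-unique , λ u∈ w∈ → visible (∈-X⁻ u∈) (∈-X⁻ w∈)
    where
    visible : ∀ {u w} → Σ _ (λ w → u ≡ (zero , codeword w)) → Σ _ (λ w′ → w ≡ (zero , codeword w′)) → Visible
      (suc N) X u w
    visible (b ∷ v , refl) (b′ ∷ v′ , refl) = Pair.visible-pair b v b′ v′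

-- Dimension 3

_≟ᵥ_ : DecidableEquality (Vertex 3)
_≟ᵥ_ = ×-≡-dec Fin._≟_ _≟ᵇ_

X₃ : List (Vertex 3)
X₃ = (# 0 , false ∷ false ∷ false ∷ []) ∷ (# 0 , false ∷ false ∷ true ∷ []) ∷
     (# 0 , false ∷ true ∷ false ∷ []) ∷ (# 0 , false ∷ true ∷ true ∷ []) ∷
     (# 1 , true ∷ false ∷ false ∷ []) ∷ (# 1 , true ∷ false ∷ true ∷ []) ∷ []

module _ {ℓ τ : Fin 3} {y x′ : Vec Bool 3} (ms : List Move) (i j : Fin 3) where
  open Routes x′
  open DistanceBound τ x′ i j
  open import Data.List.Membership.DecPropositional _≟ᵥ_ using (_∈?_)

  fixing-walk : Walk 3 (ℓ , y) (endLevel ℓ ms , fix (endLevel ℓ ms) (endBits ℓ y ms))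
  fixing-walk = route ℓ y ms ++ʷ fixWalk (endLevel ℓ ms) (endBits ℓ y ms)

  -- The three conditions are decided by evaluation at each use.
  visible-via :
    {_ : True ((endLevel ℓ ms , fix (endLevel ℓ ms) (endBits ℓ y ms)) ≟ᵥ (τ , x′))} →
    {_ : True (All.all? (λ z → ¬? (z ∈? X₃)) (internal fixing-walk))} →
    {_ : True (len fixing-walk ≤? bound (ℓ , y))} →
    Visible 3 X₃ (ℓ , y) (τ , x′)
  visible-via {ends} {avoids} {short} =
    visible-if-≤bound X₃ (toWitness ends) fixing-walk (toWitness avoids) (toWitness short)

X₃-visible : All (λ u → All (Visible 3 X₃ u) X₃) X₃
X₃-visible =
  (visible-self ∷
   visible-via (bwd ∷ fwd ∷ []) (# 0) (# 2) ∷
   visible-via (fwd ∷ bwd ∷ []) (# 0) (# 1) ∷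
   visible-via (fwd ∷ fwd ∷ fwd ∷ []) (# 1) (# 2) ∷
   visible-via (fwd ∷ []) (# 0) (# 0) ∷
   visible-via (bwd ∷ bwd ∷ []) (# 0) (# 2) ∷ []) ∷
  (visible-via (bwd ∷ fwd ∷ []) (# 0) (# 2) ∷
   visible-self ∷
   visible-via (fwd ∷ fwd ∷ fwd ∷ []) (# 1) (# 2) ∷
   visible-via (fwd ∷ bwd ∷ []) (# 0) (# 1) ∷
   visible-via (bwd ∷ bwd ∷ []) (# 0) (# 2) ∷
   visible-via (fwd ∷ []) (# 0) (# 0) ∷ []) ∷
  (visible-via (fwd ∷ bwd ∷ []) (# 0) (# 1) ∷
   visible-via (fwd ∷ fwd ∷ fwd ∷ []) (# 1) (# 2) ∷
   visible-self ∷
   visible-via (bwd ∷ fwd ∷ []) (# 0) (# 2) ∷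
   visible-via (fwd ∷ []) (# 0) (# 0) ∷
   visible-via (bwd ∷ bwd ∷ []) (# 0) (# 2) ∷ []) ∷
  (visible-via (fwd ∷ fwd ∷ fwd ∷ []) (# 1) (# 2) ∷
   visible-via (fwd ∷ bwd ∷ []) (# 0) (# 1) ∷
   visible-via (bwd ∷ fwd ∷ []) (# 0) (# 2) ∷
   visible-self ∷
   visible-via (bwd ∷ bwd ∷ []) (# 0) (# 2) ∷
   visible-via (fwd ∷ []) (# 0) (# 0) ∷ []) ∷
  (visible-via (bwd ∷ []) (# 0) (# 0) ∷
   visible-via (fwd ∷ fwd ∷ []) (# 0) (# 2) ∷
   visible-via (bwd ∷ []) (# 0) (# 0) ∷
   visible-via (fwd ∷ fwd ∷ []) (# 0) (# 2) ∷
   visible-self ∷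
   visible-via (fwd ∷ bwd ∷ []) (# 0) (# 2) ∷ []) ∷
  (visible-via (fwd ∷ fwd ∷ []) (# 0) (# 2) ∷
   visible-via (bwd ∷ []) (# 0) (# 0) ∷
   visible-via (fwd ∷ fwd ∷ []) (# 0) (# 2) ∷
   visible-via (bwd ∷ []) (# 0) (# 0) ∷
   visible-via (fwd ∷ bwd ∷ []) (# 0) (# 2) ∷
   visible-self ∷ []) ∷ []

X₃-unique : Unique X₃
X₃-unique = toWitness {a? = unique? X₃} _
  where open import Data.List.Relation.Unary.Unique.DecPropositional _≟ᵥ_ using (unique?)

X₃-mutual-visibility : IsMutualVisibilitySet 3 X₃
X₃-mutual-visibility = X₃-unique , λ u∈ w∈ → All.lookup (All.lookup X₃-visible u∈) w∈

-- Every shortest path from the cycle of x with bit ℓ flipped to [b, x] passes [ℓ, x]: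
-- fixing bit ℓ anywhere else costs two extra steps.
module Bridge (x : Vec Bool (suc n)) (ℓ b : Fin (suc n)) (b≢ℓ : b ≢ ℓ) where

  wrong : Vec Bool (suc n) → Bool
  wrong y = lookup y ℓ xor lookup x ℓ

  detour : ℕ → ℕ
  detour 1 = 2
  detour _ = 0

  -- lower bound for the moves along cycles still needed from level l
  remaining : Bool → Fin (suc n) → ℕ → ℕ
  remaining false l h = δ l b
  remaining true l h = δ l ℓ + δ ℓ b + detour h

  potential : Vertex (suc n) → ℕ
  potential (l , y) = hamming y x + remaining (wrong y) l (hamming y x)

  wrong-flipBit-other : ∀ y {l} → l ≢ ℓ → wrong (flipBit y l) ≡ wrong y
  wrong-flipBit-other y l≢ℓ = cong (_xor lookup x ℓ) (lookup-flipBit-other y (l≢ℓ ∘ sym))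

  wrong-flipBit : ∀ y → wrong (flipBit y ℓ) ≡ not (wrong y)
  wrong-flipBit y = trans (cong (_xor lookup x ℓ) (lookup-flipBit y ℓ))
    (sym (not-distribˡ-xor (lookup y ℓ) _))

  wrong⇒hamming≢0 : ∀ y → wrong y ≡ true → hamming y x ≢ 0
  wrong⇒hamming≢0 y w h≡0 with hamming≡0⇒≡ y x h≡0
  ... | refl = contradiction (trans (sym w) (xor-same (lookup x ℓ))) λ ()

  agreeing : ∀ y → wrong y ≡ false → lookup y ℓ ≡ lookup x ℓ
  agreeing y w with lookup y ℓ | lookup x ℓ
  agreeing y () | false | true
  agreeing y () | true | false
  ... | false | false = refl
  ... | true | true = refl

  disagreeing : ∀ y → wrong y ≡ true → lookup y ℓ ≢ lookup x ℓ
  disagreeing y w e rewrite e = contradiction (trans (sym w) (xor-same (lookup x ℓ))) λ ()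

  remaining-adj : ∀ {l l′ y y′} → Adj (suc n) (l , y) (l′ , y′) →
    ∀ w h → remaining w l h ≤ suc (remaining w l′ h)
  remaining-adj e false h = δ-adj e b
  remaining-adj e true h = +-monoˡ-≤ (detour h) (+-monoˡ-≤ (δ ℓ b) (δ-adj e ℓ))

  detour≤2 : ∀ h → detour h ≤ 2
  detour≤2 0 = z≤n
  detour≤2 1 = ≤-refl
  detour≤2 (suc (suc h)) = z≤n

  flip-other-step : ∀ l w {h h′} → h′ ≡ suc h ⊎ h ≡ suc h′ → (w ≡ true → h′ ≢ 0) →
    h + remaining w l h ≤ suc (h′ + remaining w l h′)
  flip-other-step l false (inj₁ refl) _ = ≤-trans (n≤1+n _) (n≤1+n _)
  flip-other-step l false (inj₂ refl) _ = ≤-refl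
  flip-other-step l true {h} (inj₁ refl) _ = begin
    h + (K + detour h)          ≤⟨ +-monoʳ-≤ h (+-monoʳ-≤ K (detour≤2 h)) ⟩
    h + (K + 2)                 ≡⟨ +-assoc h K 2 ⟨
    h + K + 2                   ≡⟨ +-comm (h + K) 2 ⟩
    suc (suc (h + K))           ≤⟨ s≤s (s≤s (+-monoʳ-≤ h (m≤m+n K _))) ⟩
    suc (suc h + (K + detour (suc h))) ∎
    where
    open ≤-Reasoning
    K : ℕ
    K = δ l ℓ + δ ℓ b
  flip-other-step l true {h′ = zero} (inj₂ refl) h′≢0 = contradiction refl (h′≢0 refl)
  flip-other-step l true {h′ = suc h″} (inj₂ refl) _ = s≤s
    (+-monoʳ-≤ (suc h″) (+-monoʳ-≤ (δ l ℓ + δ ℓ b) z≤n))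

  flip-here-step : ∀ w {h h′} → (w ≡ false → h′ ≡ suc h) → (w ≡ true → h ≡ suc h′ × h′ ≢ 0) →
    h + remaining w ℓ h ≤ suc (h′ + remaining (not w) ℓ h′)
  flip-here-step false {h} inc _ rewrite inc refl =
    ≤-trans (+-monoʳ-≤ h (≤-trans (m≤n+m (δ ℓ b) (δ ℓ ℓ)) (m≤m+n _ _))) (≤-trans (n≤1+n _) (n≤1+n _))
  flip-here-step true {h′ = zero} _ dec = contradiction refl (proj₂ (dec refl))
  flip-here-step true {h′ = suc h″} _ dec rewrite proj₁ (dec refl) =
    s≤s (≤-reflexive (cong (suc h″ +_) (trans (+-identityʳ _) (cong (_+ δ ℓ b) (δ-refl ℓ)))))

  Allowed : Vertex (suc n) → Set
  Allowed v = v ≢ (ℓ , x)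

  potential-step : ∀ {u w} → Adj (suc n) u w → Allowed u → Allowed w ⊎ w ≡ (b , x) →
    potential u ≤ suc (potential w)
  potential-step {l , y} e@(inj₁ (refl , _)) _ _ =
    ≤-trans (+-monoʳ-≤ (hamming y x) (remaining-adj e (wrong y) (hamming y x))) (≤-reflexive (+-suc _ _))
  potential-step {l , y} (inj₂ (refl , refl)) _ ok with l Fin.≟ ℓ
  ... | no l≢ℓ =
    subst (λ w → h + remaining (wrong y) l h ≤ suc (h′ + remaining w l h′)) (sym (wrong-flipBit-other y l≢ℓ))
      (flip-other-step l (wrong y) (hamming-flip y x l)
        (λ w → wrong⇒hamming≢0 y′ (trans (wrong-flipBit-other y l≢ℓ) w)))
    where
    y′ : Vec Bool (suc n)
    y′ = flipBit y l
    h h′ : ℕ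
    h = hamming y x
    h′ = hamming y′ x
  ... | yes refl =
    subst (λ w → h + remaining (wrong y) ℓ h ≤ suc (h′ + remaining w ℓ h′)) (sym (wrong-flipBit y))
      (flip-here-step (wrong y) (λ w → hamming-flip-agreeing y x ℓ (agreeing y w))
        (λ w → hamming-flip-disagreeing y x ℓ (disagreeing y w) ,
               λ h′≡0 → blocked (hamming≡0⇒≡ y′ x h′≡0) ok))
    where
    y′ : Vec Bool (suc n)
    y′ = flipBit y ℓ
    h h′ : ℕ
    h = hamming y x
    h′ = hamming y′ x
    blocked : y′ ≡ x → ¬ (Allowed (ℓ , y′) ⊎ (ℓ , y′) ≡ (b , x))
    blocked refl (inj₁ ≢ℓx) = ≢ℓx refl
    blocked refl (inj₂ e) = b≢ℓ (sym (cong proj₁ e))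

  potential-target : potential (b , x) ≡ 0
  potential-target = trans (cong₂ (λ h w → h + remaining w b h) (hamming-self x) (xor-same (lookup x ℓ)))
    (δ-refl b)

  not-visible : ∀ (Y : List (Vertex (suc n))) a → (ℓ , x) ∈ Y → ¬ Visible (suc n) Y (a , flipBit x ℓ) (b , x)
  not-visible Y a ℓx∈Y (p , p-shortest , p-avoids) = <-irrefl refl (begin-strict
    len direct                             ≡⟨ len-direct ⟩
    δ a ℓ + suc (δ ℓ b)                    ≡⟨ +-suc (δ a ℓ) (δ ℓ b) ⟩
    suc (δ a ℓ + δ ℓ b)                    <⟨ s≤s (m<m+n (δ a ℓ + δ ℓ b) z<s) ⟩
    1 + (δ a ℓ + δ ℓ b + 2)                ≡⟨ potential-y₀ ⟨
    potential (a , y₀)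
      ≤⟨ potential≤len potential Allowed (b , x) potential-step potential-target p y₀-allowed
        internal-allowed ⟩
    len p                                  ≤⟨ p-shortest direct ⟩
    len direct                             ∎)
    where
    open ≤-Reasoning
    y₀ : Vec Bool (suc n)
    y₀ = flipBit x ℓ
    direct : Walk (suc n) (a , y₀) (b , x)
    direct = proj₁ (δ-walk a ℓ y₀) ++ʷ (inj₂ (refl , sym (flipBit-involutive x ℓ)) ∷ proj₁ (δ-walk ℓ b x))
    len-direct : len direct ≡ δ a ℓ + suc (δ ℓ b)
    len-direct = trans (len-++ʷ (proj₁ (δ-walk a ℓ y₀)) _)
      (cong₂ (λ p q → p + suc q) (proj₂ (δ-walk a ℓ y₀)) (proj₂ (δ-walk ℓ b x)))
    potential-y₀ : potential (a , y₀) ≡ 1 + (δ a ℓ + δ ℓ b + 2)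
    potential-y₀ = cong₂ (λ h w → h + remaining w a h)
              (trans (hamming-flip-agreeing x x ℓ refl) (cong suc (hamming-self x)))
              (trans (wrong-flipBit x) (cong not (xor-same (lookup x ℓ))))
    y₀-allowed : Allowed (a , y₀)
    y₀-allowed e = not-¬ refl (sym (trans (sym (lookup-flipBit x ℓ)) (cong (λ v → lookup (proj₂ v) ℓ) e)))
    internal-allowed : All Allowed (internal p)
    internal-allowed = All.map (λ v∉Y v≡ → v∉Y (subst (_∈ Y) (sym v≡) ℓx∈Y)) p-avoids

length-none : ∀ {A : Set} (xs : List A) → (∀ {a} → a ∉ xs) → length xs ≡ 0
length-none [] _ = refl
length-none (a ∷ xs) ∉xs = contradiction (here refl) ∉xs

increasing-in-Fin3 : ∀ {l₁ l₂ l₃ : Fin 3} → toℕ l₁ < toℕ l₂ → toℕ l₂ < toℕ l₃ → l₁ ≡ zero × l₂ ≡ suc zero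
increasing-in-Fin3 {l₁} {l₂} {l₃} l₁<l₂ l₂<l₃ =
  Fin.toℕ-injective (n≤0⇒n≡0 (s≤s⁻¹ (≤-trans l₁<l₂ l₂≤1))) ,
  Fin.toℕ-injective (≤-antisym l₂≤1 (≤-trans (s≤s z≤n) l₁<l₂))
  where
  l₂≤1 : toℕ l₂ ≤ 1
  l₂≤1 = s≤s⁻¹ (≤-trans l₂<l₃ (s≤s⁻¹ (Fin.toℕ<n l₃)))

module _ (Y : List (Vertex 3)) (Y-mv : IsMutualVisibilitySet 3 Y) where

  private
    size : Vec Bool 3 → ℕ
    size x = length (class x Y)

  full-cycle : ∀ x → size x ≡ 3 → (zero , x) ∈ Y × (suc zero , x) ∈ Y
  full-cycle x size≡3 with cycleLevels Y (proj₁ Y-mv) x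
  ... | S , S-increasing , length-S , S⊆Y = first-two S S-increasing (trans length-S size≡3) S⊆Y
    where
    first-two : ∀ S → Increasing S → length S ≡ 3 → (∀ {l} → l ∈ S → (l , x) ∈ Y) →
      (zero , x) ∈ Y × (suc zero , x) ∈ Y
    first-two (l₁ ∷ l₂ ∷ l₃ ∷ []) (l₁<l₂ ∷ l₂<l₃ ∷ [-]) _ S⊆Y with increasing-in-Fin3 l₁<l₂ l₂<l₃
    ... | refl , refl = S⊆Y (here refl) , S⊆Y (there (here refl))

  across-full-cycle : ∀ x → (zero , x) ∈ Y → (suc zero , x) ∈ Y → size (flipBit x zero) ≡ 0
  across-full-cycle x 0x∈Y 1x∈Y = length-none (class (flipBit x zero) Y) not-in-class
    where
    not-in-class : ∀ {u} → u ∉ class (flipBit x zero) Y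
    not-in-class {a , y} u∈ with ∈-class⁻ Y u∈
    ... | u∈Y , refl = Bridge.not-visible x zero (suc zero) (λ ()) Y a 0x∈Y (proj₂ Y-mv u∈Y 1x∈Y)

  pair-≤4 : ∀ v → size (false ∷ v) + size (true ∷ v) ≤ 4
  pair-≤4 v with size (false ∷ v) ≟ 3 | size (true ∷ v) ≟ 3
  ... | yes e | _ with full-cycle _ e
  ...   | 0x∈Y , 1x∈Y =
    ≤-trans (≤-reflexive (cong₂ _+_ e (across-full-cycle (false ∷ v) 0x∈Y 1x∈Y))) (n≤1+n 3)
  pair-≤4 v | no _ | yes e with full-cycle _ e
  ...   | 0x∈Y , 1x∈Y =
    ≤-trans (≤-reflexive (cong₂ _+_ (across-full-cycle (true ∷ v) 0x∈Y 1x∈Y) e)) (n≤1+n 3)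
  pair-≤4 v | no ne₀ | no ne₁ = +-mono-≤ (≤2 (cycle-meets-≤3 Y Y-mv (false ∷ v)) ne₀)
    (≤2 (cycle-meets-≤3 Y Y-mv (true ∷ v)) ne₁)
    where
    ≤2 : ∀ {s} → s ≤ 3 → s ≢ 3 → s ≤ 2
    ≤2 s≤3 s≢3 = s≤s⁻¹ (≤∧≢⇒< s≤3 s≢3)

  μ₃≤16 : length Y ≤ 16
  μ₃≤16 = begin
    length Y                                                   ≡⟨ length≡sum-cycles Y ⟩
    sum (map size (allBitStrings 3))                           ≡⟨ sum-map-allBitStrings-suc 2 size ⟩
    sum (map (λ v → size (false ∷ v) + size (true ∷ v)) (allBitStrings 2))
      ≤⟨ sum-map-≤ _ 4 (allBitStrings 2) pair-≤4 ⟩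
    4 * length (allBitStrings 2)                               ≡⟨ cong (4 *_) (length-allBitStrings 2) ⟩
    16                                                         ∎
    where open ≤-Reasoning

Approximation : ℕ → Set
Approximation d =
  Σ (List (Vertex d)) λ X →
    IsMutualVisibilitySet d X ×
    ((Y : List (Vertex d)) → IsMutualVisibilitySet d Y → length Y ≤ 3 * 2 ^ (d / 2 ∸ 1) * length X)

approximation-3 : Approximation 3
approximation-3 = X₃ , X₃-mutual-visibility , λ Y Y-mv → ≤-trans (μ₃≤16 Y Y-mv) (toWitness {a? = 16 ≤? 18} _)

approximation-large : ∀ c k → c ≤ k + 3 → suc (c + suc k) / 2 ∸ 1 + suc c ≡ suc (c + suc k) →
  Approximation (suc (c + suc k))
approximation-large c k c≤k+3 exponents = X , X-mutual-visibility , λ Y Y-mv → begin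
  length Y                                    ≤⟨ μ≤3*2^d Y Y-mv ⟩
  3 * 2 ^ suc N                               ≡⟨ cong (λ e → 3 * 2 ^ e) exponents ⟨
  3 * 2 ^ (suc N / 2 ∸ 1 + suc c)             ≡⟨ cong (3 *_) (^-distribˡ-+-* 2 (suc N / 2 ∸ 1) (suc c)) ⟩
  3 * (2 ^ (suc N / 2 ∸ 1) * 2 ^ suc c)       ≡⟨ *-assoc 3 (2 ^ (suc N / 2 ∸ 1)) (2 ^ suc c) ⟨
  3 * 2 ^ (suc N / 2 ∸ 1) * 2 ^ suc c         ≡⟨ cong (3 * 2 ^ (suc N / 2 ∸ 1) *_) length-X ⟨
  3 * 2 ^ (suc N / 2 ∸ 1) * length X          ∎
  where
  open ≤-Reasoning
  open Construction c k c≤k+3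

-- d = 2h + r with h = ⌊d/2⌋ ≥ 2 and r ≤ 1; take c = h + r and k = h − 2.
split-dimension : ∀ d → 4 ≤ d →
  Σ ℕ λ c → Σ ℕ λ k → c ≤ k + 3 × suc (c + suc k) ≡ d × d / 2 ∸ 1 + suc c ≡ d
split-dimension d 4≤d = 2 + h′ + r , h′ , c≤k+3 , sym (trans d≡ (dimension≡ h′ r)) , exponents
  where
  r h′ : ℕ
  r = d % 2
  h′ = d / 2 ∸ 2
  half≡ : d / 2 ≡ 2 + h′
  half≡ = sym (m+[n∸m]≡n (/-monoˡ-≤ 2 4≤d))
  d≡ : d ≡ r + (2 + h′) * 2
  d≡ = trans (m≡m%n+[m/n]*n d 2) (cong (λ h → r + h * 2) half≡)
  c≤k+3 : 2 + h′ + r ≤ h′ + 3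
  c≤k+3 = subst (2 + h′ + r ≤_) (shift h′) (+-monoʳ-≤ (2 + h′) (s≤s⁻¹ (m%n<n d 2)))
    where
    shift : ∀ h′ → 2 + h′ + 1 ≡ h′ + 3
    shift = solve-∀
  dimension≡ : ∀ h′ r → r + (2 + h′) * 2 ≡ suc (2 + h′ + r + suc h′)
  dimension≡ = solve-∀
  exponents : d / 2 ∸ 1 + suc (2 + h′ + r) ≡ d
  exponents = trans (cong (λ h → h ∸ 1 + suc (2 + h′ + r)) half≡) (trans (halves h′ r) (sym d≡))
    where
    halves : ∀ h′ r → suc h′ + suc (2 + h′ + r) ≡ r + (2 + h′) * 2
    halves = solve-∀

theorem2 : (d : ℕ) → 3 ≤ d →
    Σ (List (Vertex d)) λ X →
      IsMutualVisibilitySet d X ×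
      ((Y : List (Vertex d)) → IsMutualVisibilitySet d Y →
        length Y ≤ 3 * 2 ^ (d / 2 ∸ 1) * length X)
theorem2 d 3≤d with d ≟ 3
... | yes refl = approximation-3
... | no d≢3 with split-dimension d (≤∧≢⇒< 3≤d (λ 3≡d → d≢3 (sym 3≡d)))
...   | c , k , c≤k+3 , refl , exponents = approximation-large c k c≤k+3 exponents
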